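{- Every typed $\lambda\mu^{\rightarrow\wedge\vee}$-term is strongly normalizable: if $\Gamma \vdash M : A$ is derivable in the system ${\cal S}^{\rightarrow\wedge\vee}$ (for some context $\Gamma$ and type $A$), then there is no infinite sequence of reductions $M \triangleright M_1 \triangleright M_2 \triangleright \cdots$.
   Context: Let ${\cal V}$ (term variables $x,y,\dots$) and ${\cal W}$ ($\mu$-variables $\alpha,\beta,\dots$) be disjoint infinite sets. The $\lambda\mu^{\rightarrow\wedge\vee}$-terms $M$ and eliminators $\varepsilon$ are given by $M ::= x \mid \lambda x.M \mid (M\;\varepsilon) \mid \langle M,M\rangle \mid \omega_1 M \mid \omega_2 M \mid \mu\alpha.M \mid (\alpha\; M)$, $\varepsilon ::= M \mid \pi_1 \mid \pi_2 \mid [x_1.M, x_2.M]$, where $\lambda x$, $\mu\alpha$ and the $x_i$ in $[x_1.N_1,x_2.N_2]$ are binders. $M[(\alpha\;L):=(\alpha\;(L\;\varepsilon))]$ denotes the result of replacing (recursively, inside $L$ as well) every subterm of $M$ of the form $(\alpha\;L)$ by $(\alpha\;(L\;\varepsilon))$. The reduction $\triangleright$ is the compatible closure (reduction inside any subterm) of the rules: $(\lambda x.M\;N)\triangleright M[x:=N]$; $(\mu\alpha.M\;\varepsilon)\triangleright \mu\alpha.M[(\alpha\;L):=(\alpha\;(L\;\varepsilon))]$; $(\langle M_1,M_2\rangle\;\pi_i)\triangleright M_i$; $(\omega_i M\;[x_1.N_1,x_2.N_2])\triangleright N_i[x_i:=M]$; $((M\;[x_1.N_1,x_2.N_2])\;\varepsilon)\triangleright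 (M\;[x_1.(N_1\;\varepsilon),x_2.(N_2\;\varepsilon)])$ ($i=1,2$). Types: $A ::= X \mid \bot \mid A\rightarrow A \mid A\wedge A \mid A\vee A$ with $X$ ranging over a set ${\cal A}$ of atomic constants; $\neg A$ abbreviates $A\rightarrow\bot$. A context is a set of declarations $x:A$ or $\alpha:\neg B$, each variable declared at most once. Typing rules of ${\cal S}^{\rightarrow\wedge\vee}$: $\Gamma, x:A\vdash x:A$; from $\Gamma,x:A\vdash M:B$ infer $\Gamma\vdash\lambda x.M:A\rightarrow B$; from $\Gamma\vdash M:A\rightarrow B$ and $\Gamma\vdash N:A$ infer $\Gamma\vdash (M\;N):B$; from $\Gamma,\alpha:\neg A\vdash M:A$ infer $\Gamma,\alpha:\neg A\vdash(\alpha\;M):\bot$; from $\Gamma,\alpha:\neg A\vdash M:\bot$ infer $\Gamma\vdash\mu\alpha.M:A$; from $\Gamma\vdash M:A_1$ and $\Gamma\vdash N:A_2$ infer $\Gamma\vdash\langle M,N\rangle:A_1\wedge A_2$; from $\Gamma\vdash M:A_1\wedge A_2$ infer $\Gamma\vdash(M\;\pi_i):A_i$; from $\Gamma\vdash M:A_j$ infer $\Gamma\vdash\omega_j M:A_1\vee A_2$; from $\Gamma\vdash M:A_1\vee A_2$, $\Gamma,x_1:A_1\vdash N_1:C$, $\Gamma,x_2:A_2\vdash N_2:C$ infer $\Gamma\vdash(M\;[x_1.N_1,x_2.N_2]):C$. -}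

module Defs where

open import Data.Nat using (ℕ; zero; suc; _≟_)
open import Data.List using (List; _∷_; [])
open import Data.Product using (Σ; _×_)
open import Relation.Nullary using (yes; no; ¬_)
open import Relation.Binary.PropositionalEquality using (_≡_)

-- Syntax of λμ^{→∧∨}-terms, locally nameless: de Bruijn indices for
-- both term variables (sort 𝒱) and μ-variables (sort 𝒲), which live in
-- two separate index spaces.

mutual
  data Term : Set where
    var   : ℕ → Term
    lam   : Term → Term              -- λx.M      (binds term var 0)
    app   : Term → Elim → Term
    pair  : Term → Term → Term
    ω₁    : Term → Term
    ω₂    : Term → Term
    mu    : Term → Term              -- μα.M      (binds μ-var 0)
    named : ℕ → Term → Term

  data Elim : Set where
    arg  : Term → Elim
    π₁   : Elim
    π₂   : Elim
    case : Term → Term → Elim        -- [x₁.N₁ , x₂.N₂] (each binds term var 0)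

ext : (ℕ → ℕ) → ℕ → ℕ
ext ρ zero    = zero
ext ρ (suc n) = suc (ρ n)

mutual
  renT : (ℕ → ℕ) → Term → Term
  renT ρ (var x)     = var (ρ x)
  renT ρ (lam M)     = lam (renT (ext ρ) M)
  renT ρ (app M e)   = app (renT ρ M) (renTE ρ e)
  renT ρ (pair M N)  = pair (renT ρ M) (renT ρ N)
  renT ρ (ω₁ M)      = ω₁ (renT ρ M)
  renT ρ (ω₂ M)      = ω₂ (renT ρ M)
  renT ρ (mu M)      = mu (renT ρ M)
  renT ρ (named α M) = named α (renT ρ M)

  renTE : (ℕ → ℕ) → Elim → Elim
  renTE ρ (arg N)      = arg (renT ρ N)
  renTE ρ π₁           = π₁
  renTE ρ π₂           = π₂
  renTE ρ (case N₁ N₂) = case (renT (ext ρ) N₁) (renT (ext ρ) N₂)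

mutual
  renM : (ℕ → ℕ) → Term → Term
  renM ρ (var x)     = var x
  renM ρ (lam M)     = lam (renM ρ M)
  renM ρ (app M e)   = app (renM ρ M) (renME ρ e)
  renM ρ (pair M N)  = pair (renM ρ M) (renM ρ N)
  renM ρ (ω₁ M)      = ω₁ (renM ρ M)
  renM ρ (ω₂ M)      = ω₂ (renM ρ M)
  renM ρ (mu M)      = mu (renM (ext ρ) M)
  renM ρ (named α M) = named (ρ α) (renM ρ M)

  renME : (ℕ → ℕ) → Elim → Elim
  renME ρ (arg N)      = arg (renM ρ N)
  renME ρ π₁           = π₁
  renME ρ π₂           = π₂
  renME ρ (case N₁ N₂) = case (renM ρ N₁) (renM ρ N₂)

exts : (ℕ → Term) → ℕ → Term
exts σ zero    = var zero
exts σ (suc n) = renT suc (σ n)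

extsM : (ℕ → Term) → ℕ → Term
extsM σ n = renM suc (σ n)

mutual
  sub : (ℕ → Term) → Term → Term
  sub σ (var x)     = σ x
  sub σ (lam M)     = lam (sub (exts σ) M)
  sub σ (app M e)   = app (sub σ M) (subE σ e)
  sub σ (pair M N)  = pair (sub σ M) (sub σ N)
  sub σ (ω₁ M)      = ω₁ (sub σ M)
  sub σ (ω₂ M)      = ω₂ (sub σ M)
  sub σ (mu M)      = mu (sub (extsM σ) M)
  sub σ (named α M) = named α (sub σ M)

  subE : (ℕ → Term) → Elim → Elim
  subE σ (arg N)      = arg (sub σ N)
  subE σ π₁           = π₁
  subE σ π₂           = π₂
  subE σ (case N₁ N₂) = case (sub (exts σ) N₁) (sub (exts σ) N₂)

single : Term → ℕ → Term
single N zero    = N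
single N (suc n) = var n

_[0:=_] : Term → Term → Term
M [0:= N ] = sub (single N) M

-- Structural substitution M[(α L) := (α (L ε))]  (recursively, also inside L)
mutual
  ssub : ℕ → Elim → Term → Term
  ssub α ε (var x)     = var x
  ssub α ε (lam M)     = lam (ssub α (renTE suc ε) M)
  ssub α ε (app M e)   = app (ssub α ε M) (ssubE α ε e)
  ssub α ε (pair M N)  = pair (ssub α ε M) (ssub α ε N)
  ssub α ε (ω₁ M)      = ω₁ (ssub α ε M)
  ssub α ε (ω₂ M)      = ω₂ (ssub α ε M)
  ssub α ε (mu M)      = mu (ssub (suc α) (renME suc ε) M)
  ssub α ε (named β M) with β ≟ α
  ... | yes _ = named β (app (ssub α ε M) ε)
  ... | no  _ = named β (ssub α ε M)

  ssubE : ℕ → Elim → Elim → Elim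
  ssubE α ε (arg N)      = arg (ssub α ε N)
  ssubE α ε π₁           = π₁
  ssubE α ε π₂           = π₂
  ssubE α ε (case N₁ N₂) = case (ssub α (renTE suc ε) N₁) (ssub α (renTE suc ε) N₂)

mutual
  data _▷_ : Term → Term → Set where
    β-lam  : ∀ {M N} → app (lam M) (arg N) ▷ (M [0:= N ])
    β-mu   : ∀ {M ε} → app (mu M) ε ▷ mu (ssub zero (renME suc ε) M)
    β-π₁   : ∀ {M₁ M₂} → app (pair M₁ M₂) π₁ ▷ M₁
    β-π₂   : ∀ {M₁ M₂} → app (pair M₁ M₂) π₂ ▷ M₂
    β-ω₁   : ∀ {M N₁ N₂} → app (ω₁ M) (case N₁ N₂) ▷ (N₁ [0:= M ])
    β-ω₂   : ∀ {M N₁ N₂} → app (ω₂ M) (case N₁ N₂) ▷ (N₂ [0:= M ])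
    comm   : ∀ {M N₁ N₂ ε} →
             app (app M (case N₁ N₂)) ε ▷
             app M (case (app N₁ (renTE suc ε)) (app N₂ (renTE suc ε)))
    c-lam   : ∀ {M M'} → M ▷ M' → lam M ▷ lam M'
    c-appl  : ∀ {M M' e} → M ▷ M' → app M e ▷ app M' e
    c-appr  : ∀ {M e e'} → e ▷ₑ e' → app M e ▷ app M e'
    c-pairl : ∀ {M M' N} → M ▷ M' → pair M N ▷ pair M' N
    c-pairr : ∀ {M N N'} → N ▷ N' → pair M N ▷ pair M N'
    c-ω₁    : ∀ {M M'} → M ▷ M' → ω₁ M ▷ ω₁ M'
    c-ω₂    : ∀ {M M'} → M ▷ M' → ω₂ M ▷ ω₂ M'
    c-mu    : ∀ {M M'} → M ▷ M' → mu M ▷ mu M'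
    c-named : ∀ {α M M'} → M ▷ M' → named α M ▷ named α M'

  data _▷ₑ_ : Elim → Elim → Set where
    c-arg   : ∀ {N N'} → N ▷ N' → arg N ▷ₑ arg N'
    c-casel : ∀ {N₁ N₁' N₂} → N₁ ▷ N₁' → case N₁ N₂ ▷ₑ case N₁' N₂
    c-caser : ∀ {N₁ N₂ N₂'} → N₂ ▷ N₂' → case N₁ N₂ ▷ₑ case N₁ N₂'

data Ty (𝒜 : Set) : Set where
  atom : 𝒜 → Ty 𝒜
  ⊥'   : Ty 𝒜
  _⇒_  : Ty 𝒜 → Ty 𝒜 → Ty 𝒜
  _∧_  : Ty 𝒜 → Ty 𝒜 → Ty 𝒜
  _∨_  : Ty 𝒜 → Ty 𝒜 → Ty 𝒜

infixr 7 _⇒_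

data _∋_⦂_ {A : Set} : List A → ℕ → A → Set where
  here  : ∀ {Γ T} → (T ∷ Γ) ∋ zero ⦂ T
  there : ∀ {Γ n T U} → Γ ∋ n ⦂ T → (U ∷ Γ) ∋ suc n ⦂ T

-- Typing of S^{→∧∨}.  The context is split as Γ (term variables x : A)
-- and Δ (μ-variables; an entry B in Δ at index α means α : ¬B).
data _∣_⊢_⦂_ {𝒜 : Set} (Γ Δ : List (Ty 𝒜)) : Term → Ty 𝒜 → Set where
  ⊢var   : ∀ {x A} → Γ ∋ x ⦂ A → Γ ∣ Δ ⊢ var x ⦂ A
  ⊢lam   : ∀ {M A B} → (A ∷ Γ) ∣ Δ ⊢ M ⦂ B → Γ ∣ Δ ⊢ lam M ⦂ (A ⇒ B)
  ⊢app   : ∀ {M N A B} → Γ ∣ Δ ⊢ M ⦂ (A ⇒ B) → Γ ∣ Δ ⊢ N ⦂ A →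
           Γ ∣ Δ ⊢ app M (arg N) ⦂ B
  ⊢named : ∀ {α M A} → Δ ∋ α ⦂ A → Γ ∣ Δ ⊢ M ⦂ A → Γ ∣ Δ ⊢ named α M ⦂ ⊥'
  ⊢mu    : ∀ {M A} → Γ ∣ (A ∷ Δ) ⊢ M ⦂ ⊥' → Γ ∣ Δ ⊢ mu M ⦂ A
  ⊢pair  : ∀ {M N A₁ A₂} → Γ ∣ Δ ⊢ M ⦂ A₁ → Γ ∣ Δ ⊢ N ⦂ A₂ →
           Γ ∣ Δ ⊢ pair M N ⦂ (A₁ ∧ A₂)
  ⊢π₁    : ∀ {M A₁ A₂} → Γ ∣ Δ ⊢ M ⦂ (A₁ ∧ A₂) → Γ ∣ Δ ⊢ app M π₁ ⦂ A₁
  ⊢π₂    : ∀ {M A₁ A₂} → Γ ∣ Δ ⊢ M ⦂ (A₁ ∧ A₂) → Γ ∣ Δ ⊢ app M π₂ ⦂ A₂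
  ⊢ω₁    : ∀ {M A₁ A₂} → Γ ∣ Δ ⊢ M ⦂ A₁ → Γ ∣ Δ ⊢ ω₁ M ⦂ (A₁ ∨ A₂)
  ⊢ω₂    : ∀ {M A₁ A₂} → Γ ∣ Δ ⊢ M ⦂ A₂ → Γ ∣ Δ ⊢ ω₂ M ⦂ (A₁ ∨ A₂)
  ⊢case  : ∀ {M N₁ N₂ A₁ A₂ C} → Γ ∣ Δ ⊢ M ⦂ (A₁ ∨ A₂) →
           (A₁ ∷ Γ) ∣ Δ ⊢ N₁ ⦂ C → (A₂ ∷ Γ) ∣ Δ ⊢ N₂ ⦂ C →
           Γ ∣ Δ ⊢ app M (case N₁ N₂) ⦂ C

InfiniteReduction : Term → Set
InfiniteReduction M = Σ (ℕ → Term) λ f → (f zero ≡ M) × (∀ n → f n ▷ f (suc n))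

NoInfiniteReduction : Term → Set
NoInfiniteReduction M = ¬ InfiniteReduction M

-- A term M is reducible at A when plug M K is
-- strongly normalising for every A-stack K; the A₁ ∨ A₂-stacks are those that make every
-- reducible injection strongly normalising, so the commuting conversions, which only
-- rearrange a stack, are absorbed by the interpretation itself.  Each rule of the calculus
-- then needs an expansion lemma: if the contractum of a head redex inside a stack is
-- strongly normalising, and so is whatever the contraction discards, then so is the redex.
-- For μ the relevant contractum is reached after one μ-step per eliminator of K, and it
-- is μα.N[(α L) := (α (L K))]; this is why the fundamental lemma is proved for
-- instantiations that substitute reducible terms for term variables and plug reducible
-- stacks under μ-variables.

module Submission where

open import Defs
open import Data.Nat using (ℕ; zero; suc; pred; _≟_; _≤_; s≤s)
open import Data.Nat.Properties using (suc-injective; ≤-refl; ≤-trans; n≤1+n)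
open import Data.List using (List; []; _∷_; map; _++_; length)
open import Data.List.Properties using (map-++; ++-assoc; ++-identityʳ; map-∘; map-cong; map-id)
open import Data.List.Relation.Unary.All using (All; []; _∷_)
open import Data.List.Relation.Unary.All.Properties using (map⁺; ++⁺)
import Data.List.Relation.Unary.All as All
open import Data.Product using (_×_; _,_; proj₁; proj₂)
open import Data.Unit using (⊤; tt)
open import Data.Empty using (⊥; ⊥-elim)
open import Function using (_∘_; id)
open import Relation.Nullary using (Dec; yes; no)
open import Relation.Binary.PropositionalEquality
open ≡-Reasoning
open import Relation.Binary.Construct.Closure.ReflexiveTransitive
  using (Star; _◅_; _◅◅_; gmap; return) renaming (ε to ε*)

-- Renaming and substitution
ext-∘ : ∀ {ρ ρ' ρ''} → ρ ∘ ρ' ≗ ρ'' → ext ρ ∘ ext ρ' ≗ ext ρ''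
ext-∘ h zero    = refl
ext-∘ h (suc n) = cong suc (h n)

ext-id : ∀ {ρ} → ρ ≗ id → ext ρ ≗ id
ext-id h zero    = refl
ext-id h (suc n) = cong suc (h n)

mutual
  renT-∘ : ∀ {ρ ρ' ρ''} → ρ ∘ ρ' ≗ ρ'' → ∀ M → renT ρ (renT ρ' M) ≡ renT ρ'' M
  renT-∘ h (var x)     = cong var (h x)
  renT-∘ h (lam M)     = cong lam (renT-∘ (ext-∘ h) M)
  renT-∘ h (app M e)   = cong₂ app (renT-∘ h M) (renTE-∘ h e)
  renT-∘ h (pair M N)  = cong₂ pair (renT-∘ h M) (renT-∘ h N)
  renT-∘ h (ω₁ M)      = cong ω₁ (renT-∘ h M)
  renT-∘ h (ω₂ M)      = cong ω₂ (renT-∘ h M)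
  renT-∘ h (mu M)      = cong mu (renT-∘ h M)
  renT-∘ h (named α M) = cong (named α) (renT-∘ h M)

  renTE-∘ : ∀ {ρ ρ' ρ''} → ρ ∘ ρ' ≗ ρ'' → ∀ e → renTE ρ (renTE ρ' e) ≡ renTE ρ'' e
  renTE-∘ h (arg N)      = cong arg (renT-∘ h N)
  renTE-∘ h π₁           = refl
  renTE-∘ h π₂           = refl
  renTE-∘ h (case N₁ N₂) = cong₂ case (renT-∘ (ext-∘ h) N₁) (renT-∘ (ext-∘ h) N₂)

mutual
  renM-∘ : ∀ {ρ ρ' ρ''} → ρ ∘ ρ' ≗ ρ'' → ∀ M → renM ρ (renM ρ' M) ≡ renM ρ'' M
  renM-∘ h (var x)     = refl
  renM-∘ h (lam M)     = cong lam (renM-∘ h M)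
  renM-∘ h (app M e)   = cong₂ app (renM-∘ h M) (renME-∘ h e)
  renM-∘ h (pair M N)  = cong₂ pair (renM-∘ h M) (renM-∘ h N)
  renM-∘ h (ω₁ M)      = cong ω₁ (renM-∘ h M)
  renM-∘ h (ω₂ M)      = cong ω₂ (renM-∘ h M)
  renM-∘ h (mu M)      = cong mu (renM-∘ (ext-∘ h) M)
  renM-∘ h (named α M) = cong₂ named (h α) (renM-∘ h M)

  renME-∘ : ∀ {ρ ρ' ρ''} → ρ ∘ ρ' ≗ ρ'' → ∀ e → renME ρ (renME ρ' e) ≡ renME ρ'' e
  renME-∘ h (arg N)      = cong arg (renM-∘ h N)
  renME-∘ h π₁           = refl
  renME-∘ h π₂           = refl
  renME-∘ h (case N₁ N₂) = cong₂ case (renM-∘ h N₁) (renM-∘ h N₂)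

mutual
  renM-id : ∀ {ρ} → ρ ≗ id → ∀ M → renM ρ M ≡ M
  renM-id h (var x)     = refl
  renM-id h (lam M)     = cong lam (renM-id h M)
  renM-id h (app M e)   = cong₂ app (renM-id h M) (renME-id h e)
  renM-id h (pair M N)  = cong₂ pair (renM-id h M) (renM-id h N)
  renM-id h (ω₁ M)      = cong ω₁ (renM-id h M)
  renM-id h (ω₂ M)      = cong ω₂ (renM-id h M)
  renM-id h (mu M)      = cong mu (renM-id (ext-id h) M)
  renM-id h (named α M) = cong₂ named (h α) (renM-id h M)

  renME-id : ∀ {ρ} → ρ ≗ id → ∀ e → renME ρ e ≡ e
  renME-id h (arg N)      = cong arg (renM-id h N)
  renME-id h π₁           = refl
  renME-id h π₂           = refl
  renME-id h (case N₁ N₂) = cong₂ case (renM-id h N₁) (renM-id h N₂)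

mutual
  renT-renM : ∀ ρ ρ' M → renT ρ (renM ρ' M) ≡ renM ρ' (renT ρ M)
  renT-renM ρ ρ' (var x)     = refl
  renT-renM ρ ρ' (lam M)     = cong lam (renT-renM (ext ρ) ρ' M)
  renT-renM ρ ρ' (app M e)   = cong₂ app (renT-renM ρ ρ' M) (renTE-renME ρ ρ' e)
  renT-renM ρ ρ' (pair M N)  = cong₂ pair (renT-renM ρ ρ' M) (renT-renM ρ ρ' N)
  renT-renM ρ ρ' (ω₁ M)      = cong ω₁ (renT-renM ρ ρ' M)
  renT-renM ρ ρ' (ω₂ M)      = cong ω₂ (renT-renM ρ ρ' M)
  renT-renM ρ ρ' (mu M)      = cong mu (renT-renM ρ (ext ρ') M)
  renT-renM ρ ρ' (named α M) = cong (named (ρ' α)) (renT-renM ρ ρ' M)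

  renTE-renME : ∀ ρ ρ' e → renTE ρ (renME ρ' e) ≡ renME ρ' (renTE ρ e)
  renTE-renME ρ ρ' (arg N)      = cong arg (renT-renM ρ ρ' N)
  renTE-renME ρ ρ' π₁           = refl
  renTE-renME ρ ρ' π₂           = refl
  renTE-renME ρ ρ' (case N₁ N₂) = cong₂ case (renT-renM (ext ρ) ρ' N₁) (renT-renM (ext ρ) ρ' N₂)

renT-ext-suc : ∀ ρ M → renT (ext ρ) (renT suc M) ≡ renT suc (renT ρ M)
renT-ext-suc ρ M = trans (renT-∘ (λ _ → refl) M) (sym (renT-∘ (λ _ → refl) M))

renTE-ext-suc : ∀ ρ e → renTE (ext ρ) (renTE suc e) ≡ renTE suc (renTE ρ e)
renTE-ext-suc ρ e = trans (renTE-∘ (λ _ → refl) e) (sym (renTE-∘ (λ _ → refl) e))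

renM-ext-suc : ∀ ρ M → renM (ext ρ) (renM suc M) ≡ renM suc (renM ρ M)
renM-ext-suc ρ M = trans (renM-∘ (λ _ → refl) M) (sym (renM-∘ (λ _ → refl) M))

renME-ext-suc : ∀ ρ e → renME (ext ρ) (renME suc e) ≡ renME suc (renME ρ e)
renME-ext-suc ρ e = trans (renME-∘ (λ _ → refl) e) (sym (renME-∘ (λ _ → refl) e))

exts-ext : ∀ {σ ρ σ'} → σ ∘ ρ ≗ σ' → exts σ ∘ ext ρ ≗ exts σ'
exts-ext h zero    = refl
exts-ext h (suc n) = cong (renT suc) (h n)

mutual
  sub-renT : ∀ {σ ρ σ'} → σ ∘ ρ ≗ σ' → ∀ M → sub σ (renT ρ M) ≡ sub σ' M
  sub-renT h (var x)     = h x
  sub-renT h (lam M)     = cong lam (sub-renT (exts-ext h) M)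
  sub-renT h (app M e)   = cong₂ app (sub-renT h M) (subE-renTE h e)
  sub-renT h (pair M N)  = cong₂ pair (sub-renT h M) (sub-renT h N)
  sub-renT h (ω₁ M)      = cong ω₁ (sub-renT h M)
  sub-renT h (ω₂ M)      = cong ω₂ (sub-renT h M)
  sub-renT h (mu M)      = cong mu (sub-renT (cong (renM suc) ∘ h) M)
  sub-renT h (named α M) = cong (named α) (sub-renT h M)

  subE-renTE : ∀ {σ ρ σ'} → σ ∘ ρ ≗ σ' → ∀ e → subE σ (renTE ρ e) ≡ subE σ' e
  subE-renTE h (arg N)      = cong arg (sub-renT h N)
  subE-renTE h π₁           = refl
  subE-renTE h π₂           = refl
  subE-renTE h (case N₁ N₂) = cong₂ case (sub-renT (exts-ext h) N₁) (sub-renT (exts-ext h) N₂)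

renT-exts : ∀ {σ ρ σ'} → renT ρ ∘ σ ≗ σ' → renT (ext ρ) ∘ exts σ ≗ exts σ'
renT-exts h zero          = refl
renT-exts {σ} h (suc n) = trans (renT-ext-suc _ (σ n)) (cong (renT suc) (h n))

mutual
  renT-sub : ∀ {σ ρ σ'} → renT ρ ∘ σ ≗ σ' → ∀ M → renT ρ (sub σ M) ≡ sub σ' M
  renT-sub h (var x)     = h x
  renT-sub h (lam M)     = cong lam (renT-sub (renT-exts h) M)
  renT-sub h (app M e)   = cong₂ app (renT-sub h M) (renTE-subE h e)
  renT-sub h (pair M N)  = cong₂ pair (renT-sub h M) (renT-sub h N)
  renT-sub h (ω₁ M)      = cong ω₁ (renT-sub h M)
  renT-sub h (ω₂ M)      = cong ω₂ (renT-sub h M)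
  renT-sub {σ} {ρ} h (mu M) =
    cong mu (renT-sub (λ n → trans (renT-renM ρ suc (σ n)) (cong (renM suc) (h n))) M)
  renT-sub h (named α M) = cong (named α) (renT-sub h M)

  renTE-subE : ∀ {σ ρ σ'} → renT ρ ∘ σ ≗ σ' → ∀ e → renTE ρ (subE σ e) ≡ subE σ' e
  renTE-subE h (arg N)      = cong arg (renT-sub h N)
  renTE-subE h π₁           = refl
  renTE-subE h π₂           = refl
  renTE-subE h (case N₁ N₂) = cong₂ case (renT-sub (renT-exts h) N₁) (renT-sub (renT-exts h) N₂)

renM-exts : ∀ {σ ρ σ'} → renM ρ ∘ σ ≗ σ' → renM ρ ∘ exts σ ≗ exts σ'
renM-exts h zero          = refl
renM-exts {σ} {ρ} h (suc n) = trans (sym (renT-renM suc ρ (σ n))) (cong (renT suc) (h n))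

mutual
  renM-sub : ∀ {σ ρ σ'} → renM ρ ∘ σ ≗ σ' → ∀ M → renM ρ (sub σ M) ≡ sub σ' (renM ρ M)
  renM-sub h (var x)     = h x
  renM-sub h (lam M)     = cong lam (renM-sub (renM-exts h) M)
  renM-sub h (app M e)   = cong₂ app (renM-sub h M) (renME-subE h e)
  renM-sub h (pair M N)  = cong₂ pair (renM-sub h M) (renM-sub h N)
  renM-sub h (ω₁ M)      = cong ω₁ (renM-sub h M)
  renM-sub h (ω₂ M)      = cong ω₂ (renM-sub h M)
  renM-sub {σ} h (mu M)  =
    cong mu (renM-sub (λ n → trans (renM-ext-suc _ (σ n)) (cong (renM suc) (h n))) M)
  renM-sub h (named α M) = cong (named _) (renM-sub h M)

  renME-subE : ∀ {σ ρ σ'} → renM ρ ∘ σ ≗ σ' → ∀ e → renME ρ (subE σ e) ≡ subE σ' (renME ρ e)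
  renME-subE h (arg N)      = cong arg (renM-sub h N)
  renME-subE h π₁           = refl
  renME-subE h π₂           = refl
  renME-subE h (case N₁ N₂) = cong₂ case (renM-sub (renM-exts h) N₁) (renM-sub (renM-exts h) N₂)

sub-renT-suc : ∀ σ M → sub (exts σ) (renT suc M) ≡ renT suc (sub σ M)
sub-renT-suc σ M = trans (sub-renT (λ _ → refl) M) (sym (renT-sub (λ _ → refl) M))

subE-renTE-suc : ∀ σ e → subE (exts σ) (renTE suc e) ≡ renTE suc (subE σ e)
subE-renTE-suc σ e = trans (subE-renTE (λ _ → refl) e) (sym (renTE-subE (λ _ → refl) e))

sub-renM-suc : ∀ σ M → sub (extsM σ) (renM suc M) ≡ renM suc (sub σ M)
sub-renM-suc σ M = sym (renM-sub (λ _ → refl) M)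

subE-renME-suc : ∀ σ e → subE (extsM σ) (renME suc e) ≡ renME suc (subE σ e)
subE-renME-suc σ e = sym (renME-subE (λ _ → refl) e)

sub-exts : ∀ {σ τ υ} → sub τ ∘ σ ≗ υ → sub (exts τ) ∘ exts σ ≗ exts υ
sub-exts h zero            = refl
sub-exts {σ} {τ} h (suc n) = trans (sub-renT-suc τ (σ n)) (cong (renT suc) (h n))

mutual
  sub-sub : ∀ {σ τ υ} → sub τ ∘ σ ≗ υ → ∀ M → sub τ (sub σ M) ≡ sub υ M
  sub-sub h (var x)     = h x
  sub-sub h (lam M)     = cong lam (sub-sub (sub-exts h) M)
  sub-sub h (app M e)   = cong₂ app (sub-sub h M) (subE-subE h e)
  sub-sub h (pair M N)  = cong₂ pair (sub-sub h M) (sub-sub h N)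
  sub-sub h (ω₁ M)      = cong ω₁ (sub-sub h M)
  sub-sub h (ω₂ M)      = cong ω₂ (sub-sub h M)
  sub-sub {σ} {τ} h (mu M) =
    cong mu (sub-sub (λ n → trans (sub-renM-suc τ (σ n)) (cong (renM suc) (h n))) M)
  sub-sub h (named α M) = cong (named α) (sub-sub h M)

  subE-subE : ∀ {σ τ υ} → sub τ ∘ σ ≗ υ → ∀ e → subE τ (subE σ e) ≡ subE υ e
  subE-subE h (arg N)      = cong arg (sub-sub h N)
  subE-subE h π₁           = refl
  subE-subE h π₂           = refl
  subE-subE h (case N₁ N₂) = cong₂ case (sub-sub (sub-exts h) N₁) (sub-sub (sub-exts h) N₂)

exts-var : ∀ {σ} → σ ≗ var → exts σ ≗ var
exts-var h zero    = refl
exts-var h (suc n) = cong (renT suc) (h n)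

mutual
  sub-var : ∀ {σ} → σ ≗ var → ∀ M → sub σ M ≡ M
  sub-var h (var x)     = h x
  sub-var h (lam M)     = cong lam (sub-var (exts-var h) M)
  sub-var h (app M e)   = cong₂ app (sub-var h M) (subE-var h e)
  sub-var h (pair M N)  = cong₂ pair (sub-var h M) (sub-var h N)
  sub-var h (ω₁ M)      = cong ω₁ (sub-var h M)
  sub-var h (ω₂ M)      = cong ω₂ (sub-var h M)
  sub-var h (mu M)      = cong mu (sub-var (cong (renM suc) ∘ h) M)
  sub-var h (named α M) = cong (named α) (sub-var h M)

  subE-var : ∀ {σ} → σ ≗ var → ∀ e → subE σ e ≡ e
  subE-var h (arg N)      = cong arg (sub-var h N)
  subE-var h π₁           = refl
  subE-var h π₂           = refl
  subE-var h (case N₁ N₂) = cong₂ case (sub-var (exts-var h) N₁) (sub-var (exts-var h) N₂)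

ext-as-exts : ∀ {ρ σ} → var ∘ ρ ≗ σ → var ∘ ext ρ ≗ exts σ
ext-as-exts h zero    = refl
ext-as-exts h (suc n) = cong (renT suc) (h n)

mutual
  renT-as-sub : ∀ {ρ σ} → var ∘ ρ ≗ σ → ∀ M → renT ρ M ≡ sub σ M
  renT-as-sub h (var x)     = h x
  renT-as-sub h (lam M)     = cong lam (renT-as-sub (ext-as-exts h) M)
  renT-as-sub h (app M e)   = cong₂ app (renT-as-sub h M) (renTE-as-subE h e)
  renT-as-sub h (pair M N)  = cong₂ pair (renT-as-sub h M) (renT-as-sub h N)
  renT-as-sub h (ω₁ M)      = cong ω₁ (renT-as-sub h M)
  renT-as-sub h (ω₂ M)      = cong ω₂ (renT-as-sub h M)
  renT-as-sub h (mu M)      = cong mu (renT-as-sub (cong (renM suc) ∘ h) M)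
  renT-as-sub h (named α M) = cong (named α) (renT-as-sub h M)

  renTE-as-subE : ∀ {ρ σ} → var ∘ ρ ≗ σ → ∀ e → renTE ρ e ≡ subE σ e
  renTE-as-subE h (arg N)      = cong arg (renT-as-sub h N)
  renTE-as-subE h π₁           = refl
  renTE-as-subE h π₂           = refl
  renTE-as-subE h (case N₁ N₂) =
    cong₂ case (renT-as-sub (ext-as-exts h) N₁) (renT-as-sub (ext-as-exts h) N₂)

[0:=]-renT-suc : ∀ N M → renT suc M [0:= N ] ≡ M
[0:=]-renT-suc N M = trans (sub-renT (λ _ → refl) M) (sub-var (λ _ → refl) M)

[0:=]-renTE-suc : ∀ N e → subE (single N) (renTE suc e) ≡ e
[0:=]-renTE-suc N e = trans (subE-renTE (λ _ → refl) e) (subE-var (λ _ → refl) e)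

sub-[0:=] : ∀ σ M N → sub σ (M [0:= N ]) ≡ sub (exts σ) M [0:= sub σ N ]
sub-[0:=] σ M N = trans (sub-sub (λ _ → refl) M) (sym (sub-sub after M))
  where
  after : sub (single (sub σ N)) ∘ exts σ ≗ sub σ ∘ single N
  after zero    = refl
  after (suc n) = [0:=]-renT-suc (sub σ N) (σ n)

renM-[0:=] : ∀ ρ M N → renM ρ (M [0:= N ]) ≡ renM ρ M [0:= renM ρ N ]
renM-[0:=] ρ M N = renM-sub commutes M
  where
  commutes : renM ρ ∘ single N ≗ single (renM ρ N)
  commutes zero    = refl
  commutes (suc n) = refl

-- Structural substitution
mutual
  data Fresh (α : ℕ) : Term → Set where
    f-var   : ∀ {x} → Fresh α (var x)
    f-lam   : ∀ {M} → Fresh α M → Fresh α (lam M)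
    f-app   : ∀ {M e} → Fresh α M → FreshE α e → Fresh α (app M e)
    f-pair  : ∀ {M N} → Fresh α M → Fresh α N → Fresh α (pair M N)
    f-ω₁    : ∀ {M} → Fresh α M → Fresh α (ω₁ M)
    f-ω₂    : ∀ {M} → Fresh α M → Fresh α (ω₂ M)
    f-mu    : ∀ {M} → Fresh (suc α) M → Fresh α (mu M)
    f-named : ∀ {β M} → β ≢ α → Fresh α M → Fresh α (named β M)

  data FreshE (α : ℕ) : Elim → Set where
    f-arg  : ∀ {N} → Fresh α N → FreshE α (arg N)
    f-π₁   : FreshE α π₁
    f-π₂   : FreshE α π₂
    f-case : ∀ {N₁ N₂} → Fresh α N₁ → Fresh α N₂ → FreshE α (case N₁ N₂)

ssub-named-≡ : ∀ {α β} ε M → β ≡ α → ssub α ε (named β M) ≡ named β (app (ssub α ε M) ε)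
ssub-named-≡ {α} {β} ε M β≡α with β ≟ α
... | yes _  = refl
... | no β≢α = ⊥-elim (β≢α β≡α)

ssub-named-≢ : ∀ {α β} ε M → β ≢ α → ssub α ε (named β M) ≡ named β (ssub α ε M)
ssub-named-≢ {α} {β} ε M β≢α with β ≟ α
... | yes β≡α = ⊥-elim (β≢α β≡α)
... | no _    = refl

mutual
  ssub-fresh : ∀ {α} ε {M} → Fresh α M → ssub α ε M ≡ M
  ssub-fresh ε f-var          = refl
  ssub-fresh ε (f-lam f)      = cong lam (ssub-fresh _ f)
  ssub-fresh ε (f-app f g)    = cong₂ app (ssub-fresh ε f) (ssubE-fresh ε g)
  ssub-fresh ε (f-pair f g)   = cong₂ pair (ssub-fresh ε f) (ssub-fresh ε g)
  ssub-fresh ε (f-ω₁ f)       = cong ω₁ (ssub-fresh ε f)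
  ssub-fresh ε (f-ω₂ f)       = cong ω₂ (ssub-fresh ε f)
  ssub-fresh ε (f-mu f)       = cong mu (ssub-fresh _ f)
  ssub-fresh ε (f-named {M = M} β≢α f) =
    trans (ssub-named-≢ ε M β≢α) (cong (named _) (ssub-fresh ε f))

  ssubE-fresh : ∀ {α} ε {e} → FreshE α e → ssubE α ε e ≡ e
  ssubE-fresh ε (f-arg f)    = cong arg (ssub-fresh ε f)
  ssubE-fresh ε f-π₁         = refl
  ssubE-fresh ε f-π₂         = refl
  ssubE-fresh ε (f-case f g) = cong₂ case (ssub-fresh _ f) (ssub-fresh _ g)

mutual
  fresh-renT : ∀ {α} ρ {M} → Fresh α M → Fresh α (renT ρ M)
  fresh-renT ρ f-var          = f-var
  fresh-renT ρ (f-lam f)      = f-lam (fresh-renT _ f)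
  fresh-renT ρ (f-app f g)    = f-app (fresh-renT ρ f) (fresh-renTE ρ g)
  fresh-renT ρ (f-pair f g)   = f-pair (fresh-renT ρ f) (fresh-renT ρ g)
  fresh-renT ρ (f-ω₁ f)       = f-ω₁ (fresh-renT ρ f)
  fresh-renT ρ (f-ω₂ f)       = f-ω₂ (fresh-renT ρ f)
  fresh-renT ρ (f-mu f)       = f-mu (fresh-renT ρ f)
  fresh-renT ρ (f-named n f)  = f-named n (fresh-renT ρ f)

  fresh-renTE : ∀ {α} ρ {e} → FreshE α e → FreshE α (renTE ρ e)
  fresh-renTE ρ (f-arg f)    = f-arg (fresh-renT ρ f)
  fresh-renTE ρ f-π₁         = f-π₁
  fresh-renTE ρ f-π₂         = f-π₂
  fresh-renTE ρ (f-case f g) = f-case (fresh-renT _ f) (fresh-renT _ g)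

InjectiveAt : (ℕ → ℕ) → ℕ → Set
InjectiveAt ρ α = ∀ n → ρ n ≡ ρ α → n ≡ α

injectiveAt-ext : ∀ {ρ α} → InjectiveAt ρ α → InjectiveAt (ext ρ) (suc α)
injectiveAt-ext h zero    ()
injectiveAt-ext h (suc n) p = cong suc (h n (suc-injective p))

injectiveAt-ext-zero : ∀ ρ → InjectiveAt (ext ρ) zero
injectiveAt-ext-zero ρ zero    p = refl
injectiveAt-ext-zero ρ (suc n) ()

injectiveAt-suc : ∀ α → InjectiveAt suc α
injectiveAt-suc α n = suc-injective

mutual
  fresh-renM : ∀ {α} ρ → InjectiveAt ρ α → ∀ {M} → Fresh α M → Fresh (ρ α) (renM ρ M)
  fresh-renM ρ h f-var           = f-var
  fresh-renM ρ h (f-lam f)       = f-lam (fresh-renM ρ h f)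
  fresh-renM ρ h (f-app f g)     = f-app (fresh-renM ρ h f) (fresh-renME ρ h g)
  fresh-renM ρ h (f-pair f g)    = f-pair (fresh-renM ρ h f) (fresh-renM ρ h g)
  fresh-renM ρ h (f-ω₁ f)        = f-ω₁ (fresh-renM ρ h f)
  fresh-renM ρ h (f-ω₂ f)        = f-ω₂ (fresh-renM ρ h f)
  fresh-renM ρ h (f-mu f)        = f-mu (fresh-renM (ext ρ) (injectiveAt-ext h) f)
  fresh-renM ρ h (f-named {β} n f) = f-named (n ∘ h β) (fresh-renM ρ h f)

  fresh-renME : ∀ {α} ρ → InjectiveAt ρ α → ∀ {e} → FreshE α e → FreshE (ρ α) (renME ρ e)
  fresh-renME ρ h (f-arg f)    = f-arg (fresh-renM ρ h f)
  fresh-renME ρ h f-π₁         = f-π₁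
  fresh-renME ρ h f-π₂         = f-π₂
  fresh-renME ρ h (f-case f g) = f-case (fresh-renM ρ h f) (fresh-renM ρ h g)

Avoids : (ℕ → ℕ) → ℕ → Set
Avoids ρ α = ∀ n → ρ n ≢ α

avoids-ext : ∀ {ρ α} → Avoids ρ α → Avoids (ext ρ) (suc α)
avoids-ext h zero    ()
avoids-ext h (suc n) p = h n (suc-injective p)

mutual
  fresh-avoiding-renM : ∀ {α} ρ → Avoids ρ α → ∀ M → Fresh α (renM ρ M)
  fresh-avoiding-renM ρ h (var x)     = f-var
  fresh-avoiding-renM ρ h (lam M)     = f-lam (fresh-avoiding-renM ρ h M)
  fresh-avoiding-renM ρ h (app M e)   = f-app (fresh-avoiding-renM ρ h M) (fresh-avoiding-renME ρ h e)
  fresh-avoiding-renM ρ h (pair M N)  = f-pair (fresh-avoiding-renM ρ h M) (fresh-avoiding-renM ρ h N)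
  fresh-avoiding-renM ρ h (ω₁ M)      = f-ω₁ (fresh-avoiding-renM ρ h M)
  fresh-avoiding-renM ρ h (ω₂ M)      = f-ω₂ (fresh-avoiding-renM ρ h M)
  fresh-avoiding-renM ρ h (mu M)      = f-mu (fresh-avoiding-renM (ext ρ) (avoids-ext h) M)
  fresh-avoiding-renM ρ h (named β M) = f-named (h β) (fresh-avoiding-renM ρ h M)

  fresh-avoiding-renME : ∀ {α} ρ → Avoids ρ α → ∀ e → FreshE α (renME ρ e)
  fresh-avoiding-renME ρ h (arg N)      = f-arg (fresh-avoiding-renM ρ h N)
  fresh-avoiding-renME ρ h π₁           = f-π₁
  fresh-avoiding-renME ρ h π₂           = f-π₂
  fresh-avoiding-renME ρ h (case N₁ N₂) =
    f-case (fresh-avoiding-renM ρ h N₁) (fresh-avoiding-renM ρ h N₂)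

fresh-zero-renM-suc : ∀ M → Fresh zero (renM suc M)
fresh-zero-renM-suc = fresh-avoiding-renM suc (λ _ ())

fresh-zero-renME-suc : ∀ e → FreshE zero (renME suc e)
fresh-zero-renME-suc = fresh-avoiding-renME suc (λ _ ())

fresh-renM-suc : ∀ {α M} → Fresh α M → Fresh (suc α) (renM suc M)
fresh-renM-suc = fresh-renM suc (injectiveAt-suc _)

fresh-renME-suc : ∀ {α e} → FreshE α e → FreshE (suc α) (renME suc e)
fresh-renME-suc = fresh-renME suc (injectiveAt-suc _)

mutual
  ssub-renT : ∀ {α ρ ε ε'} → ε' ≡ renTE ρ ε → ∀ M →
              ssub α ε' (renT ρ M) ≡ renT ρ (ssub α ε M)
  ssub-renT h (var x)     = refl
  ssub-renT {ρ = ρ} {ε} h (lam M) =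
    cong lam (ssub-renT (trans (cong (renTE suc) h) (sym (renTE-ext-suc ρ ε))) M)
  ssub-renT h (app M e)   = cong₂ app (ssub-renT h M) (ssubE-renTE h e)
  ssub-renT h (pair M N)  = cong₂ pair (ssub-renT h M) (ssub-renT h N)
  ssub-renT h (ω₁ M)      = cong ω₁ (ssub-renT h M)
  ssub-renT h (ω₂ M)      = cong ω₂ (ssub-renT h M)
  ssub-renT {ρ = ρ} {ε} h (mu M) =
    cong mu (ssub-renT (trans (cong (renME suc) h) (sym (renTE-renME ρ suc ε))) M)
  ssub-renT {α} h (named β M) with β ≟ α
  ... | yes _ = cong (named β) (cong₂ app (ssub-renT h M) h)
  ... | no _  = cong (named β) (ssub-renT h M)

  ssubE-renTE : ∀ {α ρ ε ε'} → ε' ≡ renTE ρ ε → ∀ e →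
                ssubE α ε' (renTE ρ e) ≡ renTE ρ (ssubE α ε e)
  ssubE-renTE h (arg N)      = cong arg (ssub-renT h N)
  ssubE-renTE h π₁           = refl
  ssubE-renTE h π₂           = refl
  ssubE-renTE {ρ = ρ} {ε} h (case N₁ N₂) = cong₂ case (ssub-renT h' N₁) (ssub-renT h' N₂)
    where h' = trans (cong (renTE suc) h) (sym (renTE-ext-suc ρ ε))

mutual
  renM-ssub : ∀ {ρ α α' ε ε'} → InjectiveAt ρ α → α' ≡ ρ α → ε' ≡ renME ρ ε → ∀ M →
              renM ρ (ssub α ε M) ≡ ssub α' ε' (renM ρ M)
  renM-ssub h q r (var x)    = refl
  renM-ssub {ρ} {ε = ε} h q r (lam M) =
    cong lam (renM-ssub h q (trans (cong (renTE suc) r) (renTE-renME suc ρ ε)) M)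
  renM-ssub h q r (app M e)  = cong₂ app (renM-ssub h q r M) (renME-ssubE h q r e)
  renM-ssub h q r (pair M N) = cong₂ pair (renM-ssub h q r M) (renM-ssub h q r N)
  renM-ssub h q r (ω₁ M)     = cong ω₁ (renM-ssub h q r M)
  renM-ssub h q r (ω₂ M)     = cong ω₂ (renM-ssub h q r M)
  renM-ssub {ρ} {ε = ε} h q r (mu M) =
    cong mu (renM-ssub (injectiveAt-ext h) (cong suc q)
                       (trans (cong (renME suc) r) (sym (renME-ext-suc ρ ε))) M)
  renM-ssub {ρ} {α} h refl r (named β M) with β ≟ α | ρ β ≟ ρ α
  ... | yes _   | yes _   = cong (named (ρ β)) (cong₂ app (renM-ssub h refl r M) (sym r))
  ... | yes β≡α | no ρβ≢  = ⊥-elim (ρβ≢ (cong ρ β≡α))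
  ... | no β≢α  | yes ρβ≡ = ⊥-elim (β≢α (h β ρβ≡))
  ... | no _    | no _    = cong (named (ρ β)) (renM-ssub h refl r M)

  renME-ssubE : ∀ {ρ α α' ε ε'} → InjectiveAt ρ α → α' ≡ ρ α → ε' ≡ renME ρ ε → ∀ e →
                renME ρ (ssubE α ε e) ≡ ssubE α' ε' (renME ρ e)
  renME-ssubE h q r (arg N)      = cong arg (renM-ssub h q r N)
  renME-ssubE h q r π₁           = refl
  renME-ssubE h q r π₂           = refl
  renME-ssubE {ρ} {ε = ε} h q r (case N₁ N₂) = cong₂ case (renM-ssub h q r' N₁) (renM-ssub h q r' N₂)
    where r' = trans (cong (renTE suc) r) (renTE-renME suc ρ ε)

ssub-renM-suc : ∀ α ε M → ssub (suc α) (renME suc ε) (renM suc M) ≡ renM suc (ssub α ε M)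
ssub-renM-suc α ε M = sym (renM-ssub (injectiveAt-suc α) refl refl M)

ssubE-renME-suc : ∀ α ε e → ssubE (suc α) (renME suc ε) (renME suc e) ≡ renME suc (ssubE α ε e)
ssubE-renME-suc α ε e = sym (renME-ssubE (injectiveAt-suc α) refl refl e)

FreshSub : ℕ → (ℕ → Term) → Set
FreshSub α σ = ∀ x → Fresh α (σ x)

freshSub-exts : ∀ {α σ} → FreshSub α σ → FreshSub α (exts σ)
freshSub-exts f zero    = f-var
freshSub-exts f (suc x) = fresh-renT suc (f x)

freshSub-extsM : ∀ {α σ} → FreshSub α σ → FreshSub (suc α) (extsM σ)
freshSub-extsM f x = fresh-renM-suc (f x)

mutual
  sub-ssub : ∀ {α σ ε ε'} → FreshSub α σ → ε' ≡ subE σ ε → ∀ M →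
             sub σ (ssub α ε M) ≡ ssub α ε' (sub σ M)
  sub-ssub f q (var x)    = sym (ssub-fresh _ (f x))
  sub-ssub {σ = σ} {ε} f q (lam M) =
    cong lam (sub-ssub (freshSub-exts f) (trans (cong (renTE suc) q) (sym (subE-renTE-suc σ ε))) M)
  sub-ssub f q (app M e)  = cong₂ app (sub-ssub f q M) (subE-ssubE f q e)
  sub-ssub f q (pair M N) = cong₂ pair (sub-ssub f q M) (sub-ssub f q N)
  sub-ssub f q (ω₁ M)     = cong ω₁ (sub-ssub f q M)
  sub-ssub f q (ω₂ M)     = cong ω₂ (sub-ssub f q M)
  sub-ssub {σ = σ} {ε} f q (mu M) =
    cong mu (sub-ssub (freshSub-extsM f) (trans (cong (renME suc) q) (sym (subE-renME-suc σ ε))) M)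
  sub-ssub {α} f q (named β M) with β ≟ α
  ... | yes _ = cong (named β) (cong₂ app (sub-ssub f q M) (sym q))
  ... | no _  = cong (named β) (sub-ssub f q M)

  subE-ssubE : ∀ {α σ ε ε'} → FreshSub α σ → ε' ≡ subE σ ε → ∀ e →
               subE σ (ssubE α ε e) ≡ ssubE α ε' (subE σ e)
  subE-ssubE f q (arg N)      = cong arg (sub-ssub f q N)
  subE-ssubE f q π₁           = refl
  subE-ssubE f q π₂           = refl
  subE-ssubE {σ = σ} {ε} f q (case N₁ N₂) =
    cong₂ case (sub-ssub (freshSub-exts f) q' N₁) (sub-ssub (freshSub-exts f) q' N₂)
    where q' = trans (cong (renTE suc) q) (sym (subE-renTE-suc σ ε))

ssub-exts : ∀ {α ε σ τ} → ssub α ε ∘ σ ≗ τ → ssub α (renTE suc ε) ∘ exts σ ≗ exts τ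
ssub-exts h zero    = refl
ssub-exts {σ = σ} h (suc n) = trans (ssub-renT refl (σ n)) (cong (renT suc) (h n))

ssub-extsM : ∀ {α ε σ τ} → ssub α ε ∘ σ ≗ τ → ssub (suc α) (renME suc ε) ∘ extsM σ ≗ extsM τ
ssub-extsM {α} {ε} {σ} h n = trans (ssub-renM-suc α ε (σ n)) (cong (renM suc) (h n))

mutual
  ssub-sub : ∀ {α ε ε₀ σ τ} → ssub α ε ∘ σ ≗ τ → subE τ ε₀ ≡ ε → ∀ M →
             ssub α ε (sub σ M) ≡ sub τ (ssub α ε₀ M)
  ssub-sub h q (var x)    = h x
  ssub-sub {ε₀ = ε₀} {τ = τ} h q (lam M) =
    cong lam (ssub-sub (ssub-exts h) (trans (subE-renTE-suc τ ε₀) (cong (renTE suc) q)) M)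
  ssub-sub h q (app M e)  = cong₂ app (ssub-sub h q M) (ssubE-subE h q e)
  ssub-sub h q (pair M N) = cong₂ pair (ssub-sub h q M) (ssub-sub h q N)
  ssub-sub h q (ω₁ M)     = cong ω₁ (ssub-sub h q M)
  ssub-sub h q (ω₂ M)     = cong ω₂ (ssub-sub h q M)
  ssub-sub {α} {ε} {ε₀} {σ} {τ} h q (mu M) =
    cong mu (ssub-sub (ssub-extsM {α} {ε} {σ} h) (trans (subE-renME-suc τ ε₀) (cong (renME suc) q)) M)
  ssub-sub {α} h q (named β M) with β ≟ α
  ... | yes _ = cong (named β) (cong₂ app (ssub-sub h q M) (sym q))
  ... | no _  = cong (named β) (ssub-sub h q M)

  ssubE-subE : ∀ {α ε ε₀ σ τ} → ssub α ε ∘ σ ≗ τ → subE τ ε₀ ≡ ε → ∀ e →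
               ssubE α ε (subE σ e) ≡ subE τ (ssubE α ε₀ e)
  ssubE-subE h q (arg N)      = cong arg (ssub-sub h q N)
  ssubE-subE h q π₁           = refl
  ssubE-subE h q π₂           = refl
  ssubE-subE {ε₀ = ε₀} {τ = τ} h q (case N₁ N₂) =
    cong₂ case (ssub-sub (ssub-exts h) q' N₁) (ssub-sub (ssub-exts h) q' N₂)
    where q' = trans (subE-renTE-suc τ ε₀) (cong (renTE suc) q)

ssub-[0:=] : ∀ α ε M N → ssub α ε (M [0:= N ]) ≡ ssub α (renTE suc ε) M [0:= ssub α ε N ]
ssub-[0:=] α ε M N = ssub-sub {σ = single N} commutes ([0:=]-renTE-suc (ssub α ε N) ε) M
  where
  commutes : ssub α ε ∘ single N ≗ single (ssub α ε N)
  commutes zero    = refl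
  commutes (suc n) = refl

ssub-ssub-named : ∀ {α β ε δ γ M} → α ≢ β → FreshE α ε →
  ssub β ε (ssub α δ M) ≡ ssub α (ssubE β ε δ) (ssub β ε M) →
  ssub β ε (ssub α δ (named γ M)) ≡ ssub α (ssubE β ε δ) (ssub β ε (named γ M))
ssub-ssub-named {α} {β} {ε} {δ} {γ} {M} n f ih = by-cases (γ ≟ α) (γ ≟ β)
  where
  δ' = ssubE β ε δ
  goal = ssub β ε (ssub α δ (named γ M)) ≡ ssub α δ' (ssub β ε (named γ M))

  by-cases : Dec (γ ≡ α) → Dec (γ ≡ β) → goal
  by-cases (yes γ≡α) (yes γ≡β) = ⊥-elim (n (trans (sym γ≡α) γ≡β))
  by-cases (yes γ≡α) (no γ≢β) = begin
    ssub β ε (ssub α δ (named γ M))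
      ≡⟨ cong (ssub β ε) (ssub-named-≡ δ M γ≡α) ⟩
    ssub β ε (named γ (app (ssub α δ M) δ))
      ≡⟨ ssub-named-≢ ε _ γ≢β ⟩
    named γ (app (ssub β ε (ssub α δ M)) δ')
      ≡⟨ cong (λ z → named γ (app z δ')) ih ⟩
    named γ (app (ssub α δ' (ssub β ε M)) δ')
      ≡⟨ sym (ssub-named-≡ δ' _ γ≡α) ⟩
    ssub α δ' (named γ (ssub β ε M))
      ≡⟨ cong (ssub α δ') (sym (ssub-named-≢ ε M γ≢β)) ⟩
    ssub α δ' (ssub β ε (named γ M)) ∎
  by-cases (no γ≢α) (yes γ≡β) = begin
    ssub β ε (ssub α δ (named γ M))
      ≡⟨ cong (ssub β ε) (ssub-named-≢ δ M γ≢α) ⟩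
    ssub β ε (named γ (ssub α δ M))
      ≡⟨ ssub-named-≡ ε _ γ≡β ⟩
    named γ (app (ssub β ε (ssub α δ M)) ε)
      ≡⟨ cong₂ (λ z w → named γ (app z w)) ih (sym (ssubE-fresh δ' f)) ⟩
    named γ (app (ssub α δ' (ssub β ε M)) (ssubE α δ' ε))
      ≡⟨ sym (ssub-named-≢ δ' _ γ≢α) ⟩
    ssub α δ' (named γ (app (ssub β ε M) ε))
      ≡⟨ cong (ssub α δ') (sym (ssub-named-≡ ε M γ≡β)) ⟩
    ssub α δ' (ssub β ε (named γ M)) ∎
  by-cases (no γ≢α) (no γ≢β) = begin
    ssub β ε (ssub α δ (named γ M))
      ≡⟨ cong (ssub β ε) (ssub-named-≢ δ M γ≢α) ⟩
    ssub β ε (named γ (ssub α δ M))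
      ≡⟨ ssub-named-≢ ε _ γ≢β ⟩
    named γ (ssub β ε (ssub α δ M))
      ≡⟨ cong (named γ) ih ⟩
    named γ (ssub α δ' (ssub β ε M))
      ≡⟨ sym (ssub-named-≢ δ' _ γ≢α) ⟩
    ssub α δ' (named γ (ssub β ε M))
      ≡⟨ cong (ssub α δ') (sym (ssub-named-≢ ε M γ≢β)) ⟩
    ssub α δ' (ssub β ε (named γ M)) ∎

mutual
  ssub-ssub : ∀ {α β ε δ} → α ≢ β → FreshE α ε → ∀ M →
              ssub β ε (ssub α δ M) ≡ ssub α (ssubE β ε δ) (ssub β ε M)
  ssub-ssub n f (var x)    = refl
  ssub-ssub {α} {β} {ε} {δ} n f (lam M) =
    trans (cong lam (ssub-ssub n (fresh-renTE suc f) M))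
          (cong (λ z → lam (ssub α z (ssub β (renTE suc ε) M))) (ssubE-renTE refl δ))
  ssub-ssub n f (app M e)  = cong₂ app (ssub-ssub n f M) (ssubE-ssubE n f e)
  ssub-ssub n f (pair M N) = cong₂ pair (ssub-ssub n f M) (ssub-ssub n f N)
  ssub-ssub n f (ω₁ M)     = cong ω₁ (ssub-ssub n f M)
  ssub-ssub n f (ω₂ M)     = cong ω₂ (ssub-ssub n f M)
  ssub-ssub {α} {β} {ε} {δ} n f (mu M) =
    trans (cong mu (ssub-ssub (n ∘ suc-injective) (fresh-renME-suc f) M))
          (cong (λ z → mu (ssub (suc α) z (ssub (suc β) (renME suc ε) M))) (ssubE-renME-suc β ε δ))
  ssub-ssub n f (named γ M) = ssub-ssub-named {γ = γ} n f (ssub-ssub n f M)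

  ssubE-ssubE : ∀ {α β ε δ} → α ≢ β → FreshE α ε → ∀ e →
                ssubE β ε (ssubE α δ e) ≡ ssubE α (ssubE β ε δ) (ssubE β ε e)
  ssubE-ssubE n f (arg N) = cong arg (ssub-ssub n f N)
  ssubE-ssubE n f π₁      = refl
  ssubE-ssubE n f π₂      = refl
  ssubE-ssubE {α} {β} {ε} {δ} n f (case N₁ N₂) = cong₂ case (under N₁) (under N₂)
    where
    under : ∀ N → ssub β (renTE suc ε) (ssub α (renTE suc δ) N)
                ≡ ssub α (renTE suc (ssubE β ε δ)) (ssub β (renTE suc ε) N)
    under N = trans (ssub-ssub n (fresh-renTE suc f) N)
                    (cong (λ z → ssub α z (ssub β (renTE suc ε) N)) (ssubE-renTE refl δ))

-- Reduction is preserved by substitutions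
_▷*_ : Term → Term → Set
_▷*_ = Star _▷_

_▷ₑ*_ : Elim → Elim → Set
_▷ₑ*_ = Star _▷ₑ_

▷-≡ : ∀ {M N N'} → M ▷ N → N ≡ N' → M ▷ N'
▷-≡ r refl = r

app*ˡ : ∀ {M M' e} → M ▷* M' → app M e ▷* app M' e
app*ˡ = gmap _ c-appl

app* : ∀ {M M' e e'} → M ▷* M' → e ▷ₑ* e' → app M e ▷* app M' e'
app* r s = app*ˡ r ◅◅ gmap _ c-appr s

lam* : ∀ {M M'} → M ▷* M' → lam M ▷* lam M'
lam* = gmap _ c-lam

pair* : ∀ {M M' N N'} → M ▷* M' → N ▷* N' → pair M N ▷* pair M' N'
pair* r s = gmap _ c-pairl r ◅◅ gmap _ c-pairr s

ω₁* : ∀ {M M'} → M ▷* M' → ω₁ M ▷* ω₁ M'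
ω₁* = gmap _ c-ω₁

ω₂* : ∀ {M M'} → M ▷* M' → ω₂ M ▷* ω₂ M'
ω₂* = gmap _ c-ω₂

mu* : ∀ {M M'} → M ▷* M' → mu M ▷* mu M'
mu* = gmap _ c-mu

named* : ∀ {α M M'} → M ▷* M' → named α M ▷* named α M'
named* = gmap _ c-named

arg* : ∀ {M M'} → M ▷* M' → arg M ▷ₑ* arg M'
arg* = gmap _ c-arg

case* : ∀ {M M' N N'} → M ▷* M' → N ▷* N' → case M N ▷ₑ* case M' N'
case* r s = gmap _ c-casel r ◅◅ gmap _ c-caser s

mutual
  sub-▷ : ∀ σ {M M'} → M ▷ M' → sub σ M ▷ sub σ M'
  sub-▷ σ (β-lam {M} {N})   = ▷-≡ β-lam (sym (sub-[0:=] σ M N))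
  sub-▷ σ (β-mu {M} {ε})    =
    ▷-≡ β-mu (cong mu (sym (sub-ssub (fresh-zero-renM-suc ∘ σ) (sym (subE-renME-suc σ ε)) M)))
  sub-▷ σ β-π₁              = β-π₁
  sub-▷ σ β-π₂              = β-π₂
  sub-▷ σ (β-ω₁ {M} {N₁})   = ▷-≡ β-ω₁ (sym (sub-[0:=] σ N₁ M))
  sub-▷ σ (β-ω₂ {M} {N₂ = N₂}) = ▷-≡ β-ω₂ (sym (sub-[0:=] σ N₂ M))
  sub-▷ σ (comm {M} {N₁} {N₂} {ε}) =
    ▷-≡ comm (cong (λ z → app (sub σ M) (case (app (sub (exts σ) N₁) z) (app (sub (exts σ) N₂) z)))
                   (sym (subE-renTE-suc σ ε)))
  sub-▷ σ (c-lam r)   = c-lam (sub-▷ _ r)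
  sub-▷ σ (c-appl r)  = c-appl (sub-▷ σ r)
  sub-▷ σ (c-appr r)  = c-appr (subE-▷ₑ σ r)
  sub-▷ σ (c-pairl r) = c-pairl (sub-▷ σ r)
  sub-▷ σ (c-pairr r) = c-pairr (sub-▷ σ r)
  sub-▷ σ (c-ω₁ r)    = c-ω₁ (sub-▷ σ r)
  sub-▷ σ (c-ω₂ r)    = c-ω₂ (sub-▷ σ r)
  sub-▷ σ (c-mu r)    = c-mu (sub-▷ _ r)
  sub-▷ σ (c-named r) = c-named (sub-▷ σ r)

  subE-▷ₑ : ∀ σ {e e'} → e ▷ₑ e' → subE σ e ▷ₑ subE σ e'
  subE-▷ₑ σ (c-arg r)   = c-arg (sub-▷ σ r)
  subE-▷ₑ σ (c-casel r) = c-casel (sub-▷ _ r)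
  subE-▷ₑ σ (c-caser r) = c-caser (sub-▷ _ r)

renTE-▷ₑ : ∀ ρ {e e'} → e ▷ₑ e' → renTE ρ e ▷ₑ renTE ρ e'
renTE-▷ₑ ρ {e} {e'} r =
  subst₂ _▷ₑ_ (sym (renTE-as-subE (λ _ → refl) e)) (sym (renTE-as-subE (λ _ → refl) e'))
         (subE-▷ₑ (var ∘ ρ) r)

mutual
  renM-▷ : ∀ ρ {M M'} → M ▷ M' → renM ρ M ▷ renM ρ M'
  renM-▷ ρ (β-lam {M} {N})   = ▷-≡ β-lam (sym (renM-[0:=] ρ M N))
  renM-▷ ρ (β-mu {M} {ε})    =
    ▷-≡ β-mu (cong mu (sym (renM-ssub (injectiveAt-ext-zero ρ) refl (sym (renME-ext-suc ρ ε)) M)))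
  renM-▷ ρ β-π₁              = β-π₁
  renM-▷ ρ β-π₂              = β-π₂
  renM-▷ ρ (β-ω₁ {M} {N₁})   = ▷-≡ β-ω₁ (sym (renM-[0:=] ρ N₁ M))
  renM-▷ ρ (β-ω₂ {M} {N₂ = N₂}) = ▷-≡ β-ω₂ (sym (renM-[0:=] ρ N₂ M))
  renM-▷ ρ (comm {M} {N₁} {N₂} {ε}) =
    ▷-≡ comm (cong (λ z → app (renM ρ M) (case (app (renM ρ N₁) z) (app (renM ρ N₂) z)))
                   (renTE-renME suc ρ ε))
  renM-▷ ρ (c-lam r)   = c-lam (renM-▷ ρ r)
  renM-▷ ρ (c-appl r)  = c-appl (renM-▷ ρ r)
  renM-▷ ρ (c-appr r)  = c-appr (renME-▷ₑ ρ r)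
  renM-▷ ρ (c-pairl r) = c-pairl (renM-▷ ρ r)
  renM-▷ ρ (c-pairr r) = c-pairr (renM-▷ ρ r)
  renM-▷ ρ (c-ω₁ r)    = c-ω₁ (renM-▷ ρ r)
  renM-▷ ρ (c-ω₂ r)    = c-ω₂ (renM-▷ ρ r)
  renM-▷ ρ (c-mu r)    = c-mu (renM-▷ (ext ρ) r)
  renM-▷ ρ (c-named r) = c-named (renM-▷ ρ r)

  renME-▷ₑ : ∀ ρ {e e'} → e ▷ₑ e' → renME ρ e ▷ₑ renME ρ e'
  renME-▷ₑ ρ (c-arg r)   = c-arg (renM-▷ ρ r)
  renME-▷ₑ ρ (c-casel r) = c-casel (renM-▷ ρ r)
  renME-▷ₑ ρ (c-caser r) = c-caser (renM-▷ ρ r)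

mutual
  ssub-▷ : ∀ α ε {M M'} → M ▷ M' → ssub α ε M ▷ ssub α ε M'
  ssub-▷ α ε (β-lam {M} {N})   = ▷-≡ β-lam (sym (ssub-[0:=] α ε M N))
  ssub-▷ α ε (β-mu {M} {δ})    = ▷-≡ β-mu (cong mu (sym (begin
    ssub (suc α) (renME suc ε) (ssub zero (renME suc δ) M)
      ≡⟨ ssub-ssub (λ ()) (fresh-zero-renME-suc ε) M ⟩
    ssub zero (ssubE (suc α) (renME suc ε) (renME suc δ)) (ssub (suc α) (renME suc ε) M)
      ≡⟨ cong (λ z → ssub zero z (ssub (suc α) (renME suc ε) M)) (ssubE-renME-suc α ε δ) ⟩
    ssub zero (renME suc (ssubE α ε δ)) (ssub (suc α) (renME suc ε) M) ∎)))
  ssub-▷ α ε β-π₁              = β-π₁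
  ssub-▷ α ε β-π₂              = β-π₂
  ssub-▷ α ε (β-ω₁ {M} {N₁})   = ▷-≡ β-ω₁ (sym (ssub-[0:=] α ε N₁ M))
  ssub-▷ α ε (β-ω₂ {M} {N₂ = N₂}) = ▷-≡ β-ω₂ (sym (ssub-[0:=] α ε N₂ M))
  ssub-▷ α ε (comm {M} {N₁} {N₂} {δ}) =
    ▷-≡ comm (cong (λ z → app (ssub α ε M) (case (app (ssub α (renTE suc ε) N₁) z)
                                                  (app (ssub α (renTE suc ε) N₂) z)))
                   (sym (ssubE-renTE refl δ)))
  ssub-▷ α ε (c-lam r)   = c-lam (ssub-▷ α _ r)
  ssub-▷ α ε (c-appl r)  = c-appl (ssub-▷ α ε r)
  ssub-▷ α ε (c-appr r)  = c-appr (ssubE-▷ₑ α ε r)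
  ssub-▷ α ε (c-pairl r) = c-pairl (ssub-▷ α ε r)
  ssub-▷ α ε (c-pairr r) = c-pairr (ssub-▷ α ε r)
  ssub-▷ α ε (c-ω₁ r)    = c-ω₁ (ssub-▷ α ε r)
  ssub-▷ α ε (c-ω₂ r)    = c-ω₂ (ssub-▷ α ε r)
  ssub-▷ α ε (c-mu r)    = c-mu (ssub-▷ (suc α) _ r)
  ssub-▷ α ε (c-named {β} r) with β ≟ α
  ... | yes _ = c-named (c-appl (ssub-▷ α ε r))
  ... | no _  = c-named (ssub-▷ α ε r)

  ssubE-▷ₑ : ∀ α ε {e e'} → e ▷ₑ e' → ssubE α ε e ▷ₑ ssubE α ε e'
  ssubE-▷ₑ α ε (c-arg r)   = c-arg (ssub-▷ α ε r)
  ssubE-▷ₑ α ε (c-casel r) = c-casel (ssub-▷ α _ r)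
  ssubE-▷ₑ α ε (c-caser r) = c-caser (ssub-▷ α _ r)

renT-▷* : ∀ ρ {M M'} → M ▷* M' → renT ρ M ▷* renT ρ M'
renT-▷* ρ = gmap _ (λ {M} {M'} r →
  subst₂ _▷_ (sym (renT-as-sub (λ _ → refl) M)) (sym (renT-as-sub (λ _ → refl) M'))
         (sub-▷ (var ∘ ρ) r))

renM-▷* : ∀ ρ {M M'} → M ▷* M' → renM ρ M ▷* renM ρ M'
renM-▷* ρ = gmap _ (renM-▷ ρ)

mutual
  sub-▷*-pointwise : ∀ {σ σ'} → (∀ n → σ n ▷* σ' n) → ∀ M → sub σ M ▷* sub σ' M
  sub-▷*-pointwise h (var x)     = h x
  sub-▷*-pointwise h (lam M)     = lam* (sub-▷*-pointwise (exts-▷* h) M)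
  sub-▷*-pointwise h (app M e)   = app* (sub-▷*-pointwise h M) (subE-▷*-pointwise h e)
  sub-▷*-pointwise h (pair M N)  = pair* (sub-▷*-pointwise h M) (sub-▷*-pointwise h N)
  sub-▷*-pointwise h (ω₁ M)      = ω₁* (sub-▷*-pointwise h M)
  sub-▷*-pointwise h (ω₂ M)      = ω₂* (sub-▷*-pointwise h M)
  sub-▷*-pointwise h (mu M)      = mu* (sub-▷*-pointwise (renM-▷* suc ∘ h) M)
  sub-▷*-pointwise h (named α M) = named* (sub-▷*-pointwise h M)

  subE-▷*-pointwise : ∀ {σ σ'} → (∀ n → σ n ▷* σ' n) → ∀ e → subE σ e ▷ₑ* subE σ' e
  subE-▷*-pointwise h (arg N)      = arg* (sub-▷*-pointwise h N)
  subE-▷*-pointwise h π₁           = ε*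
  subE-▷*-pointwise h π₂           = ε*
  subE-▷*-pointwise h (case N₁ N₂) =
    case* (sub-▷*-pointwise (exts-▷* h) N₁) (sub-▷*-pointwise (exts-▷* h) N₂)

  exts-▷* : ∀ {σ σ'} → (∀ n → σ n ▷* σ' n) → ∀ n → exts σ n ▷* exts σ' n
  exts-▷* h zero    = ε*
  exts-▷* h (suc n) = renT-▷* suc (h n)

[0:=]-▷ : ∀ {M M'} N → M ▷ M' → (M [0:= N ]) ▷ (M' [0:= N ])
[0:=]-▷ N = sub-▷ (single N)

[0:=]-▷ʳ : ∀ M {N N'} → N ▷ N' → (M [0:= N ]) ▷* (M [0:= N' ])
[0:=]-▷ʳ M r = sub-▷*-pointwise pointwise M
  where
  pointwise : ∀ n → single _ n ▷* single _ n
  pointwise zero    = return r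
  pointwise (suc n) = ε*

mutual
  ssub-▷ₑ : ∀ α {ε ε'} → ε ▷ₑ ε' → ∀ M → ssub α ε M ▷* ssub α ε' M
  ssub-▷ₑ α r (var x)     = ε*
  ssub-▷ₑ α r (lam M)     = lam* (ssub-▷ₑ α (renTE-▷ₑ suc r) M)
  ssub-▷ₑ α r (app M e)   = app* (ssub-▷ₑ α r M) (ssubE-▷ₑ* α r e)
  ssub-▷ₑ α r (pair M N)  = pair* (ssub-▷ₑ α r M) (ssub-▷ₑ α r N)
  ssub-▷ₑ α r (ω₁ M)      = ω₁* (ssub-▷ₑ α r M)
  ssub-▷ₑ α r (ω₂ M)      = ω₂* (ssub-▷ₑ α r M)
  ssub-▷ₑ α r (mu M)      = mu* (ssub-▷ₑ (suc α) (renME-▷ₑ suc r) M)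
  ssub-▷ₑ α r (named β M) with β ≟ α
  ... | yes _ = named* (app* (ssub-▷ₑ α r M) (return r))
  ... | no _  = named* (ssub-▷ₑ α r M)

  ssubE-▷ₑ* : ∀ α {ε ε'} → ε ▷ₑ ε' → ∀ e → ssubE α ε e ▷ₑ* ssubE α ε' e
  ssubE-▷ₑ* α r (arg N)      = arg* (ssub-▷ₑ α r N)
  ssubE-▷ₑ* α r π₁           = ε*
  ssubE-▷ₑ* α r π₂           = ε*
  ssubE-▷ₑ* α r (case N₁ N₂) = case* (ssub-▷ₑ α (renTE-▷ₑ suc r) N₁) (ssub-▷ₑ α (renTE-▷ₑ suc r) N₂)

caseThen : Term → Term → Elim → Elim
caseThen N₁ N₂ ε = case (app N₁ (renTE suc ε)) (app N₂ (renTE suc ε))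

caseThen-renT : ∀ ρ N₁ N₂ ε →
  caseThen (renT (ext ρ) N₁) (renT (ext ρ) N₂) (renTE ρ ε) ≡ renTE ρ (caseThen N₁ N₂ ε)
caseThen-renT ρ N₁ N₂ ε =
  cong₂ case (cong (app _) (sym (renTE-ext-suc ρ ε))) (cong (app _) (sym (renTE-ext-suc ρ ε)))

caseThen-renM : ∀ ρ N₁ N₂ ε →
  caseThen (renM ρ N₁) (renM ρ N₂) (renME ρ ε) ≡ renME ρ (caseThen N₁ N₂ ε)
caseThen-renM ρ N₁ N₂ ε =
  cong₂ case (cong (app _) (renTE-renME suc ρ ε)) (cong (app _) (renTE-renME suc ρ ε))

ssub-ssub-case-named : ∀ {α ε N₁ N₂ γ M} → FreshE α (case N₁ N₂) →
  ssub α ε (ssub α (case N₁ N₂) M) ▷* ssub α (caseThen N₁ N₂ ε) M →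
  ssub α ε (ssub α (case N₁ N₂) (named γ M)) ▷* ssub α (caseThen N₁ N₂ ε) (named γ M)
ssub-ssub-case-named {α} {ε} {N₁} {N₂} {γ} {M} g ih = by-cases (γ ≟ α)
  where
  by-cases : Dec (γ ≡ α) →
    ssub α ε (ssub α (case N₁ N₂) (named γ M)) ▷* ssub α (caseThen N₁ N₂ ε) (named γ M)
  by-cases (yes γ≡α) =
    subst₂ _▷*_ (sym lhs) (sym (ssub-named-≡ _ M γ≡α)) (named* (comm ◅ app*ˡ ih))
    where
    lhs : ssub α ε (ssub α (case N₁ N₂) (named γ M))
        ≡ named γ (app (app (ssub α ε (ssub α (case N₁ N₂) M)) (case N₁ N₂)) ε)
    lhs = begin
      ssub α ε (ssub α (case N₁ N₂) (named γ M))
        ≡⟨ cong (ssub α ε) (ssub-named-≡ _ M γ≡α) ⟩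
      ssub α ε (named γ (app (ssub α (case N₁ N₂) M) (case N₁ N₂)))
        ≡⟨ ssub-named-≡ ε _ γ≡α ⟩
      named γ (app (app (ssub α ε (ssub α (case N₁ N₂) M)) (ssubE α ε (case N₁ N₂))) ε)
        ≡⟨ cong (λ z → named γ (app (app (ssub α ε (ssub α (case N₁ N₂) M)) z) ε)) (ssubE-fresh ε g) ⟩
      named γ (app (app (ssub α ε (ssub α (case N₁ N₂) M)) (case N₁ N₂)) ε) ∎
  by-cases (no γ≢α) =
    subst₂ _▷*_ (sym (trans (cong (ssub α ε) (ssub-named-≢ _ M γ≢α)) (ssub-named-≢ ε _ γ≢α)))
                (sym (ssub-named-≢ _ M γ≢α)) (named* ih)

mutual
  ssub-ssub-case : ∀ α {ε N₁ N₂} → FreshE α ε → FreshE α (case N₁ N₂) → ∀ M →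
    ssub α ε (ssub α (case N₁ N₂) M) ▷* ssub α (caseThen N₁ N₂ ε) M
  ssub-ssub-case α f g (var x)     = ε*
  ssub-ssub-case α {ε} {N₁} {N₂} f g (lam M) =
    lam* (subst (λ z → ssub α (renTE suc ε) (ssub α (renTE suc (case N₁ N₂)) M) ▷* ssub α z M)
                (caseThen-renT suc N₁ N₂ ε)
                (ssub-ssub-case α (fresh-renTE suc f) (fresh-renTE suc g) M))
  ssub-ssub-case α f g (app M e)   = app* (ssub-ssub-case α f g M) (ssubE-ssubE-case α f g e)
  ssub-ssub-case α f g (pair M N)  = pair* (ssub-ssub-case α f g M) (ssub-ssub-case α f g N)
  ssub-ssub-case α f g (ω₁ M)      = ω₁* (ssub-ssub-case α f g M)
  ssub-ssub-case α f g (ω₂ M)      = ω₂* (ssub-ssub-case α f g M)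
  ssub-ssub-case α {ε} {N₁} {N₂} f g (mu M) =
    mu* (subst (λ z → ssub (suc α) (renME suc ε) (ssub (suc α) (renME suc (case N₁ N₂)) M)
                      ▷* ssub (suc α) z M)
               (caseThen-renM suc N₁ N₂ ε)
               (ssub-ssub-case (suc α) (fresh-renME-suc f) (fresh-renME-suc g) M))
  ssub-ssub-case α f g (named γ M) = ssub-ssub-case-named {γ = γ} g (ssub-ssub-case α f g M)

  ssubE-ssubE-case : ∀ α {ε N₁ N₂} → FreshE α ε → FreshE α (case N₁ N₂) → ∀ e →
    ssubE α ε (ssubE α (case N₁ N₂) e) ▷ₑ* ssubE α (caseThen N₁ N₂ ε) e
  ssubE-ssubE-case α f g (arg N) = arg* (ssub-ssub-case α f g N)
  ssubE-ssubE-case α f g π₁      = ε*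
  ssubE-ssubE-case α f g π₂      = ε*
  ssubE-ssubE-case α {ε} {N₁} {N₂} f g (case P₁ P₂) = case* (under P₁) (under P₂)
    where
    under : ∀ P → ssub α (renTE suc ε) (ssub α (renTE suc (case N₁ N₂)) P)
                  ▷* ssub α (renTE suc (caseThen N₁ N₂ ε)) P
    under P = subst (λ z → ssub α (renTE suc ε) (ssub α (renTE suc (case N₁ N₂)) P) ▷* ssub α z P)
                    (caseThen-renT suc N₁ N₂ ε)
                    (ssub-ssub-case α (fresh-renTE suc f) (fresh-renTE suc g) P)

-- Stacks and head reduction
Stack : Set
Stack = List Elim

plug : Term → Stack → Term
plug M []      = M
plug M (e ∷ K) = plug (app M e) K

data _▷ₛ_ : Stack → Stack → Set where
  s-here  : ∀ {e e' K} → e ▷ₑ e' → (e ∷ K) ▷ₛ (e' ∷ K)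
  s-there : ∀ {e K K'} → K ▷ₛ K' → (e ∷ K) ▷ₛ (e ∷ K')
  s-comm  : ∀ {N₁ N₂ e K} → (case N₁ N₂ ∷ e ∷ K) ▷ₛ (caseThen N₁ N₂ e ∷ K)

data _▷ₕ_ : Term → Term → Set where
  h-lam  : ∀ {M N} → app (lam M) (arg N) ▷ₕ (M [0:= N ])
  h-mu   : ∀ {M ε} → app (mu M) ε ▷ₕ mu (ssub zero (renME suc ε) M)
  h-π₁   : ∀ {M₁ M₂} → app (pair M₁ M₂) π₁ ▷ₕ M₁
  h-π₂   : ∀ {M₁ M₂} → app (pair M₁ M₂) π₂ ▷ₕ M₂
  h-ω₁   : ∀ {M N₁ N₂} → app (ω₁ M) (case N₁ N₂) ▷ₕ (N₁ [0:= M ])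
  h-ω₂   : ∀ {M N₁ N₂} → app (ω₂ M) (case N₁ N₂) ▷ₕ (N₂ [0:= M ])
  h-comm : ∀ {M N₁ N₂ ε} → app (app M (case N₁ N₂)) ε ▷ₕ app M (caseThen N₁ N₂ ε)

data AppReduct (M : Term) (e : Elim) (Y : Term) : Set where
  in-fun  : ∀ {M'} → M ▷ M' → Y ≡ app M' e → AppReduct M e Y
  in-elim : ∀ {e'} → e ▷ₑ e' → Y ≡ app M e' → AppReduct M e Y
  at-head : app M e ▷ₕ Y → AppReduct M e Y

app-reduct : ∀ {M e Y} → app M e ▷ Y → AppReduct M e Y
app-reduct β-lam      = at-head h-lam
app-reduct β-mu       = at-head h-mu
app-reduct β-π₁       = at-head h-π₁
app-reduct β-π₂       = at-head h-π₂
app-reduct β-ω₁       = at-head h-ω₁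
app-reduct β-ω₂       = at-head h-ω₂
app-reduct comm       = at-head h-comm
app-reduct (c-appl r) = in-fun r refl
app-reduct (c-appr r) = in-elim r refl

data PlugReduct (M : Term) (K : Stack) (Y : Term) : Set where
  in-term  : ∀ {M'} → M ▷ M' → Y ≡ plug M' K → PlugReduct M K Y
  in-stack : ∀ {K'} → K ▷ₛ K' → Y ≡ plug M K' → PlugReduct M K Y
  at-head  : ∀ {e K' M'} → K ≡ e ∷ K' → app M e ▷ₕ M' → Y ≡ plug M' K' → PlugReduct M K Y

plug-reduct : ∀ M K {Y} → plug M K ▷ Y → PlugReduct M K Y
plug-reduct M []      r = in-term r refl
plug-reduct M (e ∷ K) r with plug-reduct (app M e) K r
... | in-term r' eq with app-reduct r'
...   | in-fun s refl  = in-term s eq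
...   | in-elim s refl = in-stack (s-here s) eq
...   | at-head h      = at-head refl h eq
plug-reduct M (e ∷ K) r | in-stack s eq            = in-stack (s-there s) eq
plug-reduct M (e ∷ K) r | at-head refl h-comm eq   = in-stack s-comm eq

plug-▷ : ∀ {M M'} K → M ▷ M' → plug M K ▷ plug M' K
plug-▷ []      r = r
plug-▷ (e ∷ K) r = plug-▷ K (c-appl r)

plug-▷* : ∀ {M M'} K → M ▷* M' → plug M K ▷* plug M' K
plug-▷* K = gmap _ (plug-▷ K)

plug-▷ₛ : ∀ M {K K'} → K ▷ₛ K' → plug M K ▷ plug M K'
plug-▷ₛ M (s-here {K = K} r) = plug-▷ K (c-appr r)
plug-▷ₛ M (s-there {e} s)    = plug-▷ₛ (app M e) s
plug-▷ₛ M (s-comm {K = K})   = plug-▷ K comm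

-- Strong normalisation and head expansion
data SN (M : Term) : Set where
  sn : (∀ {N} → M ▷ N → SN N) → SN M

data SNₛ (K : Stack) : Set where
  snₛ : (∀ {K'} → K ▷ₛ K' → SNₛ K') → SNₛ K

SN-▷* : ∀ {M N} → SN M → M ▷* N → SN N
SN-▷* s      ε*       = s
SN-▷* (sn h) (r ◅ rs) = SN-▷* (h r) rs

SN-reflect : (f : Term → Term) → (∀ {M N} → M ▷ N → f M ▷ f N) → ∀ {M} → SN (f M) → SN M
SN-reflect f f-▷ s = go s refl
  where
  go : ∀ {X M} → SN X → X ≡ f M → SN M
  go (sn h) refl = sn λ r → go (h (f-▷ r)) refl

SN-app-fun : ∀ {M e} → SN (app M e) → SN M
SN-app-fun {e = e} = SN-reflect (λ M → app M e) c-appl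

SN-named : ∀ {α M} → SN M → SN (named α M)
SN-named (sn h) = sn λ { (c-named r) → SN-named (h r) }

SN-ω₁ : ∀ {M} → SN M → SN (ω₁ M)
SN-ω₁ (sn h) = sn λ { (c-ω₁ r) → SN-ω₁ (h r) }

SN-ω₂ : ∀ {M} → SN M → SN (ω₂ M)
SN-ω₂ (sn h) = sn λ { (c-ω₂ r) → SN-ω₂ (h r) }

SN-pair : ∀ {M N} → SN M → SN N → SN (pair M N)
SN-pair (sn h) (sn k) =
  sn λ { (c-pairl r) → SN-pair (h r) (sn k) ; (c-pairr r) → SN-pair (sn h) (k r) }

SNₛ-plug : ∀ {M K} → SN (plug M K) → SNₛ K
SNₛ-plug {M} s = go s refl
  where
  go : ∀ {X K} → SN X → X ≡ plug M K → SNₛ K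
  go (sn h) refl = snₛ λ r → go (h (plug-▷ₛ M r)) refl

SNₛ-tail : ∀ {e K} → SNₛ (e ∷ K) → SNₛ K
SNₛ-tail (snₛ h) = snₛ λ r → SNₛ-tail (h (s-there r))

SNₛ-[] : SNₛ []
SNₛ-[] = snₛ λ ()

SNₛ-arg : ∀ {N K} → SN N → SNₛ K → SNₛ (arg N ∷ K)
SNₛ-arg (sn h) (snₛ k) =
  snₛ λ { (s-here (c-arg r)) → SNₛ-arg (h r) (snₛ k) ; (s-there r) → SNₛ-arg (sn h) (k r) }

SNₛ-π₁ : ∀ {K} → SNₛ K → SNₛ (π₁ ∷ K)
SNₛ-π₁ (snₛ k) = snₛ λ { (s-there r) → SNₛ-π₁ (k r) ; (s-here ()) }

SNₛ-π₂ : ∀ {K} → SNₛ K → SNₛ (π₂ ∷ K)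
SNₛ-π₂ (snₛ k) = snₛ λ { (s-there r) → SNₛ-π₂ (k r) ; (s-here ()) }

SN-plug-var : ∀ {x K} → SNₛ K → SN (plug (var x) K)
SN-plug-var {x} {K} (snₛ h) = sn λ r → reduct (plug-reduct (var x) K r)
  where
  reduct : ∀ {Y} → PlugReduct (var x) K Y → SN Y
  reduct (in-term () _)
  reduct (in-stack s refl) = SN-plug-var (h s)
  reduct (at-head refl () _)

data FirstStep (X T' : Term) : Set where
  first-step : ∀ {X₁} → X ▷ X₁ → X₁ ▷* T' → FirstStep X T'

first-step-of : ∀ {X T T'} → X ▷* T → T ▷ T' → FirstStep X T'
first-step-of ε*      r = first-step r ε*
first-step-of (a ◅ s) r = first-step a (s ◅◅ return r)

SN-expand-lam : ∀ {M N K} → SN (plug (M [0:= N ]) K) → SN N → SN (plug (app (lam M) (arg N)) K)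
SN-expand-lam {M} {N} {K} s t = go s M N K ε* t
  where
  go : ∀ {X} → SN X → ∀ M N K → X ▷* plug (M [0:= N ]) K → SN N →
       SN (plug (app (lam M) (arg N)) K)
  go {X} (sn hX) M N K p (sn hN) = sn λ r → reduct (plug-reduct _ K r)
    where
    reduct : ∀ {Y} → PlugReduct (app (lam M) (arg N)) K Y → SN Y
    reduct (in-term r refl) with app-reduct r
    ... | in-fun (c-lam {M' = M'} s) refl with first-step-of p (plug-▷ K ([0:=]-▷ N s))
    ...   | first-step a q = go (hX a) M' N K q (sn hN)
    reduct (in-term r refl) | in-elim (c-arg {N' = N'} s) refl =
      go (sn hX) M N' K (p ◅◅ plug-▷* K ([0:=]-▷ʳ M s)) (hN s)
    reduct (in-term r refl) | at-head h-lam = SN-▷* (sn hX) p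
    reduct (in-stack {K'} s refl) with first-step-of p (plug-▷ₛ _ s)
    ... | first-step a q = go (hX a) M N K' q (sn hN)
    reduct (at-head refl () _)

SN-expand-π₁ : ∀ {M₁ M₂ K} → SN (plug M₁ K) → SN M₂ → SN (plug (app (pair M₁ M₂) π₁) K)
SN-expand-π₁ {M₁} {M₂} {K} s t = go s M₁ M₂ K ε* t
  where
  go : ∀ {X} → SN X → ∀ M₁ M₂ K → X ▷* plug M₁ K → SN M₂ → SN (plug (app (pair M₁ M₂) π₁) K)
  go {X} (sn hX) M₁ M₂ K p (sn hN) = sn λ r → reduct (plug-reduct _ K r)
    where
    reduct : ∀ {Y} → PlugReduct (app (pair M₁ M₂) π₁) K Y → SN Y
    reduct (in-term r refl) with app-reduct r
    ... | in-fun (c-pairl {M' = M'} s) refl with first-step-of p (plug-▷ K s)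
    ...   | first-step a q = go (hX a) M' M₂ K q (sn hN)
    reduct (in-term r refl) | in-fun (c-pairr {N' = N'} s) refl = go (sn hX) M₁ N' K p (hN s)
    reduct (in-term r refl) | in-elim () _
    reduct (in-term r refl) | at-head h-π₁ = SN-▷* (sn hX) p
    reduct (in-stack {K'} s refl) with first-step-of p (plug-▷ₛ _ s)
    ... | first-step a q = go (hX a) M₁ M₂ K' q (sn hN)
    reduct (at-head refl () _)

SN-expand-π₂ : ∀ {M₁ M₂ K} → SN (plug M₂ K) → SN M₁ → SN (plug (app (pair M₁ M₂) π₂) K)
SN-expand-π₂ {M₁} {M₂} {K} s t = go s M₁ M₂ K ε* t
  where
  go : ∀ {X} → SN X → ∀ M₁ M₂ K → X ▷* plug M₂ K → SN M₁ → SN (plug (app (pair M₁ M₂) π₂) K)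
  go {X} (sn hX) M₁ M₂ K p (sn hN) = sn λ r → reduct (plug-reduct _ K r)
    where
    reduct : ∀ {Y} → PlugReduct (app (pair M₁ M₂) π₂) K Y → SN Y
    reduct (in-term r refl) with app-reduct r
    ... | in-fun (c-pairr {N' = N'} s) refl with first-step-of p (plug-▷ K s)
    ...   | first-step a q = go (hX a) M₁ N' K q (sn hN)
    reduct (in-term r refl) | in-fun (c-pairl {M' = M'} s) refl = go (sn hX) M' M₂ K p (hN s)
    reduct (in-term r refl) | in-elim () _
    reduct (in-term r refl) | at-head h-π₂ = SN-▷* (sn hX) p
    reduct (in-stack {K'} s refl) with first-step-of p (plug-▷ₛ _ s)
    ... | first-step a q = go (hX a) M₁ M₂ K' q (sn hN)
    reduct (at-head refl () _)

-- A commuting conversion on `case N₁ N₂ ∷ e ∷ K'` only moves `e` into the branches, so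
-- the invariant `X ▷* plug (Nᵢ[0:=P]) K` survives it without any step of X.
SN-expand-ω₁ : ∀ {P N₁ N₂ K} → SN (plug (N₁ [0:= P ]) K) → SN P → SNₛ (case N₁ N₂ ∷ K) →
               SN (plug (app (ω₁ P) (case N₁ N₂)) K)
SN-expand-ω₁ {P} {N₁} {N₂} {K} s t u = go s P N₁ N₂ K ε* t u
  where
  go : ∀ {X} → SN X → ∀ P N₁ N₂ K → X ▷* plug (N₁ [0:= P ]) K → SN P → SNₛ (case N₁ N₂ ∷ K) →
       SN (plug (app (ω₁ P) (case N₁ N₂)) K)
  go {X} (sn hX) P N₁ N₂ K p (sn hP) (snₛ hK) = sn λ r → reduct (plug-reduct _ K r)
    where
    reduct : ∀ {Y} → PlugReduct (app (ω₁ P) (case N₁ N₂)) K Y → SN Y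
    reduct (in-term r refl) with app-reduct r
    ... | in-fun (c-ω₁ {M' = P'} s) refl =
      go (sn hX) P' N₁ N₂ K (p ◅◅ plug-▷* K ([0:=]-▷ʳ N₁ s)) (hP s) (snₛ hK)
    ... | in-elim (c-casel {N₁' = N₁'} s) refl with first-step-of p (plug-▷ K ([0:=]-▷ P s))
    ...   | first-step a q = go (hX a) P N₁' N₂ K q (sn hP) (hK (s-here (c-casel s)))
    reduct (in-term r refl) | in-elim (c-caser {N₂' = N₂'} s) refl =
      go (sn hX) P N₁ N₂' K p (sn hP) (hK (s-here (c-caser s)))
    reduct (in-term r refl) | at-head h-ω₁ = SN-▷* (sn hX) p
    reduct (in-stack {K'} s refl) with first-step-of p (plug-▷ₛ _ s)
    ... | first-step a q = go (hX a) P N₁ N₂ K' q (sn hP) (hK (s-there s))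
    reduct (at-head {e} {K'} refl h-comm refl) =
      go (sn hX) P (app N₁ (renTE suc e)) (app N₂ (renTE suc e)) K'
         (subst (λ z → X ▷* plug (app (N₁ [0:= P ]) z) K') (sym ([0:=]-renTE-suc P e)) p)
         (sn hP) (hK s-comm)

SN-expand-ω₂ : ∀ {P N₁ N₂ K} → SN (plug (N₂ [0:= P ]) K) → SN P → SNₛ (case N₁ N₂ ∷ K) →
               SN (plug (app (ω₂ P) (case N₁ N₂)) K)
SN-expand-ω₂ {P} {N₁} {N₂} {K} s t u = go s P N₁ N₂ K ε* t u
  where
  go : ∀ {X} → SN X → ∀ P N₁ N₂ K → X ▷* plug (N₂ [0:= P ]) K → SN P → SNₛ (case N₁ N₂ ∷ K) →
       SN (plug (app (ω₂ P) (case N₁ N₂)) K)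
  go {X} (sn hX) P N₁ N₂ K p (sn hP) (snₛ hK) = sn λ r → reduct (plug-reduct _ K r)
    where
    reduct : ∀ {Y} → PlugReduct (app (ω₂ P) (case N₁ N₂)) K Y → SN Y
    reduct (in-term r refl) with app-reduct r
    ... | in-fun (c-ω₂ {M' = P'} s) refl =
      go (sn hX) P' N₁ N₂ K (p ◅◅ plug-▷* K ([0:=]-▷ʳ N₂ s)) (hP s) (snₛ hK)
    ... | in-elim (c-caser {N₂' = N₂'} s) refl with first-step-of p (plug-▷ K ([0:=]-▷ P s))
    ...   | first-step a q = go (hX a) P N₁ N₂' K q (sn hP) (hK (s-here (c-caser s)))
    reduct (in-term r refl) | in-elim (c-casel {N₁' = N₁'} s) refl =
      go (sn hX) P N₁' N₂ K p (sn hP) (hK (s-here (c-casel s)))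
    reduct (in-term r refl) | at-head h-ω₂ = SN-▷* (sn hX) p
    reduct (in-stack {K'} s refl) with first-step-of p (plug-▷ₛ _ s)
    ... | first-step a q = go (hX a) P N₁ N₂ K' q (sn hP) (hK (s-there s))
    reduct (at-head {e} {K'} refl h-comm refl) =
      go (sn hX) P (app N₁ (renTE suc e)) (app N₂ (renTE suc e)) K'
         (subst (λ z → X ▷* plug (app (N₂ [0:= P ]) z) K') (sym ([0:=]-renTE-suc P e)) p)
         (sn hP) (hK s-comm)

weakenT : Stack → Stack
weakenT = map (renTE suc)

weakenM : Stack → Stack
weakenM = map (renME suc)

weakenT-▷ₛ : ∀ {K K'} → K ▷ₛ K' → weakenT K ▷ₛ weakenT K'
weakenT-▷ₛ (s-here r)  = s-here (renTE-▷ₑ suc r)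
weakenT-▷ₛ (s-there s) = s-there (weakenT-▷ₛ s)
weakenT-▷ₛ (s-comm {N₁} {N₂} {e} {K}) =
  subst (λ z → weakenT (case N₁ N₂ ∷ e ∷ K) ▷ₛ (z ∷ weakenT K)) (caseThen-renT suc N₁ N₂ e) s-comm

-- Each branch sees the rest of the stack from under one more binder, whence the weakening.
SNₛ-case : ∀ {N₁ N₂ K} → SN (plug N₁ (weakenT K)) → SN (plug N₂ (weakenT K)) → SNₛ (case N₁ N₂ ∷ K)
SNₛ-case {N₁} {N₂} {K} s₁ s₂ = snₛ (steps N₁ N₂ K s₁ s₂)
  where
  steps : ∀ N₁ N₂ K → SN (plug N₁ (weakenT K)) → SN (plug N₂ (weakenT K)) →
          ∀ {K''} → (case N₁ N₂ ∷ K) ▷ₛ K'' → SNₛ K''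
  steps N₁ N₂ K (sn h₁) s₂ (s-here (c-casel {N₁' = N₁'} r)) =
    snₛ (steps N₁' N₂ K (h₁ (plug-▷ (weakenT K) r)) s₂)
  steps N₁ N₂ K s₁ (sn h₂) (s-here (c-caser {N₂' = N₂'} r)) =
    snₛ (steps N₁ N₂' K s₁ (h₂ (plug-▷ (weakenT K) r)))
  steps N₁ N₂ K (sn h₁) (sn h₂) (s-there {K' = K'} r) =
    snₛ (steps N₁ N₂ K' (h₁ (plug-▷ₛ N₁ (weakenT-▷ₛ r))) (h₂ (plug-▷ₛ N₂ (weakenT-▷ₛ r))))
  steps N₁ N₂ (e ∷ K) s₁ s₂ s-comm =
    snₛ (steps (app N₁ (renTE suc e)) (app N₂ (renTE suc e)) K s₁ s₂)

ssubStack : ℕ → Stack → Term → Term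
ssubStack α []      N = N
ssubStack α (e ∷ K) N = ssubStack α K (ssub α e N)

ssubStack-▷ : ∀ α K {N N'} → N ▷ N' → ssubStack α K N ▷ ssubStack α K N'
ssubStack-▷ α []      r = r
ssubStack-▷ α (e ∷ K) r = ssubStack-▷ α K (ssub-▷ α e r)

ssubStack-▷* : ∀ α K {N N'} → N ▷* N' → ssubStack α K N ▷* ssubStack α K N'
ssubStack-▷* α K = gmap _ (ssubStack-▷ α K)

ssubStack-▷ₛ : ∀ {K K'} → K ▷ₛ K' → ∀ N → ssubStack zero (weakenM K) N ▷* ssubStack zero (weakenM K') N
ssubStack-▷ₛ (s-here {K = K} r) N = ssubStack-▷* zero (weakenM K) (ssub-▷ₑ zero (renME-▷ₑ suc r) N)
ssubStack-▷ₛ (s-there {e} s)    N = ssubStack-▷ₛ s (ssub zero (renME suc e) N)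
ssubStack-▷ₛ (s-comm {N₁} {N₂} {e} {K}) N = ssubStack-▷* zero (weakenM K)
  (subst (λ z → ssub zero (renME suc e) (ssub zero (case (renM suc N₁) (renM suc N₂)) N) ▷* ssub zero z N)
         (caseThen-renM suc N₁ N₂ e)
         (ssub-ssub-case zero (fresh-zero-renME-suc e) (fresh-zero-renME-suc (case N₁ N₂)) N))

-- Accessibility for stack reduction together with dropping the first eliminator:
-- a μ-step at the head of `plug (mu N) (e ∷ K)` continues with the stack K.
data SNₛ-tails (K : Stack) : Set where
  snₛ-tails : (∀ {K'} → K ▷ₛ K' → SNₛ-tails K') → (∀ {e K'} → K ≡ e ∷ K' → SNₛ-tails K') → SNₛ-tails K

length-▷ₛ : ∀ {K K'} → K ▷ₛ K' → length K' ≤ length K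
length-▷ₛ (s-here r)  = ≤-refl
length-▷ₛ (s-there s) = s≤s (length-▷ₛ s)
length-▷ₛ s-comm      = s≤s (n≤1+n _)

SNₛ⇒SNₛ-tails : ∀ {K} → SNₛ K → SNₛ-tails K
SNₛ⇒SNₛ-tails {K} = bounded (length K) K ≤-refl
  where
  mutual
    bounded : ∀ n K → length K ≤ n → SNₛ K → SNₛ-tails K
    bounded n K l (snₛ h) =
      snₛ-tails (λ {K'} s → bounded n K' (≤-trans (length-▷ₛ s) l) (h s))
                (λ { refl → tail n l (snₛ h) })

    tail : ∀ n {e K'} → length (e ∷ K') ≤ n → SNₛ (e ∷ K') → SNₛ-tails K'
    tail (suc n) {K' = K'} (s≤s l) s = bounded n K' l (SNₛ-tail s)

-- `plug (mu N) K` reduces to `mu (ssubStack zero (weakenM K) N)` by μ-steps.  Every step of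
-- the former is matched by steps of the latter; when none is matched the stack decreases.
SN-expand-mu : ∀ {N K} → SN (ssubStack zero (weakenM K) N) → SNₛ K → SN (plug (mu N) K)
SN-expand-mu {N} {K} s t = go s N K ε* (SNₛ⇒SNₛ-tails t)
  where
  mutual
    go : ∀ {X} → SN X → ∀ N K → X ▷* ssubStack zero (weakenM K) N → SNₛ-tails K → SN (plug (mu N) K)
    go s N K p t = sn λ r → reduct s N K p t (plug-reduct _ K r)

    reduct : ∀ {X} → SN X → ∀ N K → X ▷* ssubStack zero (weakenM K) N → SNₛ-tails K →
             ∀ {Y} → PlugReduct (mu N) K Y → SN Y
    reduct (sn hX) N K p t (in-term (c-mu {M' = N'} r) refl)
      with first-step-of p (ssubStack-▷ zero (weakenM K) r)
    ... | first-step a q = go (hX a) N' K q t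
    reduct s N K p (snₛ-tails t _) (in-stack {K'} r refl) = go s N K' (p ◅◅ ssubStack-▷ₛ r N) (t r)
    reduct s N (e ∷ K) p (snₛ-tails _ t) (at-head refl h-mu refl) =
      go s (ssub zero (renME suc e) N) K p (t refl)

-- Instantiation
liftStacks : (ℕ → Stack) → ℕ → Stack
liftStacks θ zero    = []
liftStacks θ (suc β) = weakenM (θ β)

-- Term variables x ↦ σ x, and every named term (α M) becomes (ρ α (M θ(α))): the μ-variable
-- α is renamed to ρ α and the stack θ α is plugged under it.  This is the paper's
-- M[σ][(α L) := (α (L K))] for all α at once.
mutual
  inst : (ℕ → Term) → (ℕ → ℕ) → (ℕ → Stack) → Term → Term
  inst σ ρ θ (var x)     = σ x
  inst σ ρ θ (lam M)     = lam (inst (exts σ) ρ (weakenT ∘ θ) M)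
  inst σ ρ θ (app M e)   = app (inst σ ρ θ M) (instE σ ρ θ e)
  inst σ ρ θ (pair M N)  = pair (inst σ ρ θ M) (inst σ ρ θ N)
  inst σ ρ θ (ω₁ M)      = ω₁ (inst σ ρ θ M)
  inst σ ρ θ (ω₂ M)      = ω₂ (inst σ ρ θ M)
  inst σ ρ θ (mu M)      = mu (inst (extsM σ) (ext ρ) (liftStacks θ) M)
  inst σ ρ θ (named α M) = named (ρ α) (plug (inst σ ρ θ M) (θ α))

  instE : (ℕ → Term) → (ℕ → ℕ) → (ℕ → Stack) → Elim → Elim
  instE σ ρ θ (arg N)      = arg (inst σ ρ θ N)
  instE σ ρ θ π₁           = π₁
  instE σ ρ θ π₂           = π₂
  instE σ ρ θ (case N₁ N₂) = case (inst (exts σ) ρ (weakenT ∘ θ) N₁) (inst (exts σ) ρ (weakenT ∘ θ) N₂)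

plug-sub : ∀ σ M K → sub σ (plug M K) ≡ plug (sub σ M) (map (subE σ) K)
plug-sub σ M []      = refl
plug-sub σ M (e ∷ K) = plug-sub σ (app M e) K

plug-renM : ∀ ρ M K → renM ρ (plug M K) ≡ plug (renM ρ M) (map (renME ρ) K)
plug-renM ρ M []      = refl
plug-renM ρ M (e ∷ K) = plug-renM ρ (app M e) K

plug-ssub : ∀ α ε M K → ssub α ε (plug M K) ≡ plug (ssub α ε M) (map (ssubE α ε) K)
plug-ssub α ε M []      = refl
plug-ssub α ε M (e ∷ K) = plug-ssub α ε (app M e) K

plug-∷ʳ : ∀ M K e → plug M (K ++ e ∷ []) ≡ app (plug M K) e
plug-∷ʳ M []       e = refl
plug-∷ʳ M (e' ∷ K) e = plug-∷ʳ (app M e') K e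

map-commute : ∀ {f g f' g' : Elim → Elim} → f ∘ g ≗ g' ∘ f' → map f ∘ map g ≗ map g' ∘ map f'
map-commute h K = trans (sym (map-∘ K)) (trans (map-cong h K) (map-∘ K))

mutual
  inst-cong : ∀ {σ σ' ρ ρ' θ θ'} → σ ≗ σ' → ρ ≗ ρ' → θ ≗ θ' → ∀ M → inst σ ρ θ M ≡ inst σ' ρ' θ' M
  inst-cong hσ hρ hθ (var x)     = hσ x
  inst-cong hσ hρ hθ (lam M)     = cong lam (inst-cong (exts-cong hσ) hρ (cong weakenT ∘ hθ) M)
  inst-cong hσ hρ hθ (app M e)   = cong₂ app (inst-cong hσ hρ hθ M) (instE-cong hσ hρ hθ e)
  inst-cong hσ hρ hθ (pair M N)  = cong₂ pair (inst-cong hσ hρ hθ M) (inst-cong hσ hρ hθ N)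
  inst-cong hσ hρ hθ (ω₁ M)      = cong ω₁ (inst-cong hσ hρ hθ M)
  inst-cong hσ hρ hθ (ω₂ M)      = cong ω₂ (inst-cong hσ hρ hθ M)
  inst-cong hσ hρ hθ (mu M)      =
    cong mu (inst-cong (cong (renM suc) ∘ hσ) (ext-cong hρ) (liftStacks-cong hθ) M)
  inst-cong hσ hρ hθ (named α M) = cong₂ named (hρ α) (cong₂ plug (inst-cong hσ hρ hθ M) (hθ α))

  instE-cong : ∀ {σ σ' ρ ρ' θ θ'} → σ ≗ σ' → ρ ≗ ρ' → θ ≗ θ' → ∀ e → instE σ ρ θ e ≡ instE σ' ρ' θ' e
  instE-cong hσ hρ hθ (arg N)      = cong arg (inst-cong hσ hρ hθ N)
  instE-cong hσ hρ hθ π₁           = refl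
  instE-cong hσ hρ hθ π₂           = refl
  instE-cong hσ hρ hθ (case N₁ N₂) =
    cong₂ case (inst-cong (exts-cong hσ) hρ (cong weakenT ∘ hθ) N₁)
               (inst-cong (exts-cong hσ) hρ (cong weakenT ∘ hθ) N₂)

  exts-cong : ∀ {σ σ'} → σ ≗ σ' → exts σ ≗ exts σ'
  exts-cong h zero    = refl
  exts-cong h (suc n) = cong (renT suc) (h n)

  ext-cong : ∀ {ρ ρ'} → ρ ≗ ρ' → ext ρ ≗ ext ρ'
  ext-cong h zero    = refl
  ext-cong h (suc n) = cong suc (h n)

  liftStacks-cong : ∀ {θ θ'} → θ ≗ θ' → liftStacks θ ≗ liftStacks θ'
  liftStacks-cong h zero    = refl
  liftStacks-cong h (suc n) = cong weakenM (h n)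

mutual
  inst-id : ∀ {σ ρ θ} → σ ≗ var → ρ ≗ id → θ ≗ (λ _ → []) → ∀ M → inst σ ρ θ M ≡ M
  inst-id hσ hρ hθ (var x)     = hσ x
  inst-id hσ hρ hθ (lam M)     = cong lam (inst-id (exts-var hσ) hρ (cong weakenT ∘ hθ) M)
  inst-id hσ hρ hθ (app M e)   = cong₂ app (inst-id hσ hρ hθ M) (instE-id hσ hρ hθ e)
  inst-id hσ hρ hθ (pair M N)  = cong₂ pair (inst-id hσ hρ hθ M) (inst-id hσ hρ hθ N)
  inst-id hσ hρ hθ (ω₁ M)      = cong ω₁ (inst-id hσ hρ hθ M)
  inst-id hσ hρ hθ (ω₂ M)      = cong ω₂ (inst-id hσ hρ hθ M)
  inst-id hσ hρ hθ (mu M)      = cong mu (inst-id (cong (renM suc) ∘ hσ) (ext-id hρ) lifted M)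
    where
    lifted : liftStacks _ ≗ (λ _ → [])
    lifted zero    = refl
    lifted (suc n) = cong weakenM (hθ n)
  inst-id hσ hρ hθ (named α M) =
    cong₂ named (hρ α) (trans (cong (plug _) (hθ α)) (inst-id hσ hρ hθ M))

  instE-id : ∀ {σ ρ θ} → σ ≗ var → ρ ≗ id → θ ≗ (λ _ → []) → ∀ e → instE σ ρ θ e ≡ e
  instE-id hσ hρ hθ (arg N)      = cong arg (inst-id hσ hρ hθ N)
  instE-id hσ hρ hθ π₁           = refl
  instE-id hσ hρ hθ π₂           = refl
  instE-id hσ hρ hθ (case N₁ N₂) =
    cong₂ case (inst-id (exts-var hσ) hρ (cong weakenT ∘ hθ) N₁)
               (inst-id (exts-var hσ) hρ (cong weakenT ∘ hθ) N₂)

mutual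
  sub-inst : ∀ {τ σ σ' ρ θ θ'} → sub τ ∘ σ ≗ σ' → map (subE τ) ∘ θ ≗ θ' → ∀ M →
             sub τ (inst σ ρ θ M) ≡ inst σ' ρ θ' M
  sub-inst hσ hθ (var x)    = hσ x
  sub-inst {τ} {θ = θ} hσ hθ (lam M) =
    cong lam (sub-inst (sub-exts hσ) (λ n → trans (map-commute (subE-renTE-suc τ) (θ n))
                                                   (cong weakenT (hθ n))) M)
  sub-inst hσ hθ (app M e)  = cong₂ app (sub-inst hσ hθ M) (subE-instE hσ hθ e)
  sub-inst hσ hθ (pair M N) = cong₂ pair (sub-inst hσ hθ M) (sub-inst hσ hθ N)
  sub-inst hσ hθ (ω₁ M)     = cong ω₁ (sub-inst hσ hθ M)
  sub-inst hσ hθ (ω₂ M)     = cong ω₂ (sub-inst hσ hθ M)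
  sub-inst {τ} {σ} {θ = θ} hσ hθ (mu M) =
    cong mu (sub-inst (λ n → trans (sub-renM-suc τ (σ n)) (cong (renM suc) (hσ n))) lifted M)
    where
    lifted : map (subE (extsM τ)) ∘ liftStacks θ ≗ liftStacks _
    lifted zero    = refl
    lifted (suc n) = trans (map-commute (subE-renME-suc τ) (θ n)) (cong weakenM (hθ n))
  sub-inst {τ} {σ} {ρ = ρ} {θ} hσ hθ (named α M) = cong (named (ρ α))
    (trans (plug-sub τ (inst σ ρ θ M) (θ α)) (cong₂ plug (sub-inst hσ hθ M) (hθ α)))

  subE-instE : ∀ {τ σ σ' ρ θ θ'} → sub τ ∘ σ ≗ σ' → map (subE τ) ∘ θ ≗ θ' → ∀ e →
               subE τ (instE σ ρ θ e) ≡ instE σ' ρ θ' e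
  subE-instE hσ hθ (arg N)      = cong arg (sub-inst hσ hθ N)
  subE-instE hσ hθ π₁           = refl
  subE-instE hσ hθ π₂           = refl
  subE-instE {τ} {θ = θ} hσ hθ (case N₁ N₂) =
    cong₂ case (sub-inst (sub-exts hσ) weakened N₁) (sub-inst (sub-exts hσ) weakened N₂)
    where
    weakened : map (subE (exts τ)) ∘ weakenT ∘ θ ≗ weakenT ∘ _
    weakened n = trans (map-commute (subE-renTE-suc τ) (θ n)) (cong weakenT (hθ n))

mutual
  renM-inst : ∀ {ρ σ σ' ϕ ϕ' θ θ'} → renM ρ ∘ σ ≗ σ' → ρ ∘ ϕ ≗ ϕ' → map (renME ρ) ∘ θ ≗ θ' → ∀ M →
              renM ρ (inst σ ϕ θ M) ≡ inst σ' ϕ' θ' M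
  renM-inst hσ hϕ hθ (var x)    = hσ x
  renM-inst {ρ} {θ = θ} hσ hϕ hθ (lam M) =
    cong lam (renM-inst (renM-exts hσ) hϕ
                        (λ n → trans (map-commute (sym ∘ renTE-renME suc ρ) (θ n)) (cong weakenT (hθ n))) M)
  renM-inst hσ hϕ hθ (app M e)  = cong₂ app (renM-inst hσ hϕ hθ M) (renME-instE hσ hϕ hθ e)
  renM-inst hσ hϕ hθ (pair M N) = cong₂ pair (renM-inst hσ hϕ hθ M) (renM-inst hσ hϕ hθ N)
  renM-inst hσ hϕ hθ (ω₁ M)     = cong ω₁ (renM-inst hσ hϕ hθ M)
  renM-inst hσ hϕ hθ (ω₂ M)     = cong ω₂ (renM-inst hσ hϕ hθ M)
  renM-inst {ρ} {σ} {θ = θ} hσ hϕ hθ (mu M) =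
    cong mu (renM-inst (λ n → trans (renM-ext-suc ρ (σ n)) (cong (renM suc) (hσ n))) (ext-∘ hϕ) lifted M)
    where
    lifted : map (renME (ext ρ)) ∘ liftStacks θ ≗ liftStacks _
    lifted zero    = refl
    lifted (suc n) = trans (map-commute (renME-ext-suc ρ) (θ n)) (cong weakenM (hθ n))
  renM-inst {ρ} {σ} {ϕ = ϕ} {θ = θ} hσ hϕ hθ (named α M) = cong₂ named (hϕ α)
    (trans (plug-renM ρ (inst σ ϕ θ M) (θ α)) (cong₂ plug (renM-inst hσ hϕ hθ M) (hθ α)))

  renME-instE : ∀ {ρ σ σ' ϕ ϕ' θ θ'} → renM ρ ∘ σ ≗ σ' → ρ ∘ ϕ ≗ ϕ' → map (renME ρ) ∘ θ ≗ θ' → ∀ e →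
                renME ρ (instE σ ϕ θ e) ≡ instE σ' ϕ' θ' e
  renME-instE hσ hϕ hθ (arg N)      = cong arg (renM-inst hσ hϕ hθ N)
  renME-instE hσ hϕ hθ π₁           = refl
  renME-instE hσ hϕ hθ π₂           = refl
  renME-instE {ρ} {θ = θ} hσ hϕ hθ (case N₁ N₂) =
    cong₂ case (renM-inst (renM-exts hσ) hϕ weakened N₁) (renM-inst (renM-exts hσ) hϕ weakened N₂)
    where
    weakened : map (renME ρ) ∘ weakenT ∘ θ ≗ weakenT ∘ _
    weakened n = trans (map-commute (sym ∘ renTE-renME suc ρ) (θ n)) (cong weakenT (hθ n))

AppendsAt : ℕ → Elim → (ℕ → ℕ) → (ℕ → Stack) → (ℕ → Stack) → Set
AppendsAt α ε ρ θ θ' = ∀ β → (ρ β ≡ α → θ' β ≡ θ β ++ ε ∷ []) × (ρ β ≢ α → θ' β ≡ θ β)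

appendsAt-weakenT : ∀ {α ε ρ θ θ'} → AppendsAt α ε ρ θ θ' →
                    AppendsAt α (renTE suc ε) ρ (weakenT ∘ θ) (weakenT ∘ θ')
appendsAt-weakenT {ε = ε} {θ = θ} h β =
    (λ p → trans (cong weakenT (proj₁ (h β) p)) (map-++ (renTE suc) (θ β) (ε ∷ [])))
  , (λ np → cong weakenT (proj₂ (h β) np))

appendsAt-liftStacks : ∀ {α ε ρ θ θ'} → AppendsAt α ε ρ θ θ' →
                       AppendsAt (suc α) (renME suc ε) (ext ρ) (liftStacks θ) (liftStacks θ')
appendsAt-liftStacks h zero = (λ ()) , (λ _ → refl)
appendsAt-liftStacks {ε = ε} {θ = θ} h (suc β) =
    (λ p → trans (cong weakenM (proj₁ (h β) (suc-injective p))) (map-++ (renME suc) (θ β) (ε ∷ [])))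
  , (λ np → cong weakenM (proj₂ (h β) (np ∘ cong suc)))

FreshStacks : ℕ → (ℕ → Stack) → Set
FreshStacks α θ = ∀ β → All (FreshE α) (θ β)

freshStacks-weakenT : ∀ {α θ} → FreshStacks α θ → FreshStacks α (weakenT ∘ θ)
freshStacks-weakenT f β = map⁺ (All.map (fresh-renTE suc) (f β))

freshStacks-liftStacks : ∀ {α θ} → FreshStacks α θ → FreshStacks (suc α) (liftStacks θ)
freshStacks-liftStacks f zero    = []
freshStacks-liftStacks f (suc β) = map⁺ (All.map fresh-renME-suc (f β))

ssubStack-fresh : ∀ {α} ε {K} → All (FreshE α) K → map (ssubE α ε) K ≡ K
ssubStack-fresh ε []       = refl
ssubStack-fresh ε (f ∷ fs) = cong₂ _∷_ (ssubE-fresh ε f) (ssubStack-fresh ε fs)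

mutual
  ssub-inst : ∀ {α ε σ ρ θ θ'} → FreshSub α σ → FreshStacks α θ → AppendsAt α ε ρ θ θ' → ∀ M →
              ssub α ε (inst σ ρ θ M) ≡ inst σ ρ θ' M
  ssub-inst fσ fθ h (var x)    = ssub-fresh _ (fσ x)
  ssub-inst fσ fθ h (lam M)    =
    cong lam (ssub-inst (freshSub-exts fσ) (freshStacks-weakenT fθ) (appendsAt-weakenT h) M)
  ssub-inst fσ fθ h (app M e)  = cong₂ app (ssub-inst fσ fθ h M) (ssubE-instE fσ fθ h e)
  ssub-inst fσ fθ h (pair M N) = cong₂ pair (ssub-inst fσ fθ h M) (ssub-inst fσ fθ h N)
  ssub-inst fσ fθ h (ω₁ M)     = cong ω₁ (ssub-inst fσ fθ h M)
  ssub-inst fσ fθ h (ω₂ M)     = cong ω₂ (ssub-inst fσ fθ h M)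
  ssub-inst fσ fθ h (mu M)     =
    cong mu (ssub-inst (freshSub-extsM fσ) (freshStacks-liftStacks fθ) (appendsAt-liftStacks h) M)
  ssub-inst {α} {ε} {σ} {ρ} {θ} {θ'} fσ fθ h (named β M) with ρ β ≟ α
  ... | yes p = cong (named (ρ β)) (begin
    app (ssub α ε (plug (inst σ ρ θ M) (θ β))) ε
      ≡⟨ cong (λ z → app z ε) (plug-ssub α ε (inst σ ρ θ M) (θ β)) ⟩
    app (plug (ssub α ε (inst σ ρ θ M)) (map (ssubE α ε) (θ β))) ε
      ≡⟨ cong (λ z → app z ε) (cong₂ plug (ssub-inst fσ fθ h M) (ssubStack-fresh ε (fθ β))) ⟩
    app (plug (inst σ ρ θ' M) (θ β)) ε
      ≡⟨ sym (plug-∷ʳ (inst σ ρ θ' M) (θ β) ε) ⟩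
    plug (inst σ ρ θ' M) (θ β ++ ε ∷ [])
      ≡⟨ cong (plug (inst σ ρ θ' M)) (sym (proj₁ (h β) p)) ⟩
    plug (inst σ ρ θ' M) (θ' β) ∎)
  ... | no np = cong (named (ρ β)) (trans (plug-ssub α ε (inst σ ρ θ M) (θ β))
      (cong₂ plug (ssub-inst fσ fθ h M) (trans (ssubStack-fresh ε (fθ β)) (sym (proj₂ (h β) np)))))

  ssubE-instE : ∀ {α ε σ ρ θ θ'} → FreshSub α σ → FreshStacks α θ → AppendsAt α ε ρ θ θ' → ∀ e →
                ssubE α ε (instE σ ρ θ e) ≡ instE σ ρ θ' e
  ssubE-instE fσ fθ h (arg N)      = cong arg (ssub-inst fσ fθ h N)
  ssubE-instE fσ fθ h π₁           = refl
  ssubE-instE fσ fθ h π₂           = refl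
  ssubE-instE fσ fθ h (case N₁ N₂) =
    cong₂ case (ssub-inst (freshSub-exts fσ) (freshStacks-weakenT fθ) (appendsAt-weakenT h) N₁)
               (ssub-inst (freshSub-exts fσ) (freshStacks-weakenT fθ) (appendsAt-weakenT h) N₂)

appendAt-zero : (ℕ → Stack) → Stack → ℕ → Stack
appendAt-zero θ K zero    = θ zero ++ K
appendAt-zero θ K (suc β) = θ (suc β)

ssubStack-inst : ∀ {σ ρ θ} K → FreshSub zero σ → FreshStacks zero θ → All (FreshE zero) K → ∀ M →
                 ssubStack zero K (inst σ (ext ρ) θ M) ≡ inst σ (ext ρ) (appendAt-zero θ K) M
ssubStack-inst {σ} {ρ} {θ} [] fσ fθ fK M = inst-cong (λ _ → refl) (λ _ → refl) unchanged M
  where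
  unchanged : θ ≗ appendAt-zero θ []
  unchanged zero    = sym (++-identityʳ (θ zero))
  unchanged (suc β) = refl
ssubStack-inst {σ} {ρ} {θ} (e ∷ K) fσ fθ (fe ∷ fK) M = begin
  ssubStack zero K (ssub zero e (inst σ (ext ρ) θ M))
    ≡⟨ cong (ssubStack zero K) (ssub-inst fσ fθ appends M) ⟩
  ssubStack zero K (inst σ (ext ρ) θ₁ M)
    ≡⟨ ssubStack-inst K fσ fθ₁ fK M ⟩
  inst σ (ext ρ) (appendAt-zero θ₁ K) M
    ≡⟨ inst-cong (λ _ → refl) (λ _ → refl) reassociate M ⟩
  inst σ (ext ρ) (appendAt-zero θ (e ∷ K)) M ∎
  where
  θ₁ = appendAt-zero θ (e ∷ [])

  appends : AppendsAt zero e (ext ρ) θ θ₁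
  appends zero    = (λ _ → refl) , (λ np → ⊥-elim (np refl))
  appends (suc β) = (λ ()) , (λ _ → refl)

  fθ₁ : FreshStacks zero θ₁
  fθ₁ zero    = ++⁺ (fθ zero) (fe ∷ [])
  fθ₁ (suc β) = fθ (suc β)

  reassociate : appendAt-zero θ₁ K ≗ appendAt-zero θ (e ∷ K)
  reassociate zero    = ++-assoc (θ zero) (e ∷ []) K
  reassociate (suc β) = refl

-- Reducibility
weakenT-[0:=] : ∀ N K → map (subE (single N)) (weakenT K) ≡ K
weakenT-[0:=] N []      = refl
weakenT-[0:=] N (e ∷ K) = cong₂ _∷_ ([0:=]-renTE-suc N e) (weakenT-[0:=] N K)

SN-plug-weakenT : ∀ N K → SN (plug (N [0:= var zero ]) K) → SN (plug N (weakenT K))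
SN-plug-weakenT N K s = SN-reflect (sub (single (var zero))) (sub-▷ _) (subst SN (sym (begin
  sub (single (var zero)) (plug N (weakenT K))
    ≡⟨ plug-sub (single (var zero)) N (weakenT K) ⟩
  plug (N [0:= var zero ]) (map (subE (single (var zero))) (weakenT K))
    ≡⟨ cong (plug (N [0:= var zero ])) (weakenT-[0:=] (var zero) K) ⟩
  plug (N [0:= var zero ]) K ∎)) s)

module Reducibility {𝒜 : Set} where

  -- Stacks for a
  -- disjunction are defined by orthogonality to the reducible injections; this is what
  -- absorbs the commuting conversions.
  mutual
    Red : Ty 𝒜 → Term → Set
    Red A M = ∀ K → RedStack A K → SN (plug M K)

    RedStack : Ty 𝒜 → Stack → Set
    RedStack (atom _) K                = K ≡ []
    RedStack ⊥'       K                = K ≡ []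
    RedStack (A ⇒ B)  []               = ⊤
    RedStack (A ⇒ B)  (arg N ∷ K)      = Red A N × RedStack B K
    RedStack (A ⇒ B)  (π₁ ∷ K)         = ⊥
    RedStack (A ⇒ B)  (π₂ ∷ K)         = ⊥
    RedStack (A ⇒ B)  (case _ _ ∷ K)   = ⊥
    RedStack (A ∧ B)  []               = ⊤
    RedStack (A ∧ B)  (π₁ ∷ K)         = RedStack A K
    RedStack (A ∧ B)  (π₂ ∷ K)         = RedStack B K
    RedStack (A ∧ B)  (arg _ ∷ K)      = ⊥
    RedStack (A ∧ B)  (case _ _ ∷ K)   = ⊥
    RedStack (A ∨ B)  K =
      (∀ P → Red A P → SN (plug (ω₁ P) K)) × (∀ P → Red B P → SN (plug (ω₂ P) K))

  mutual
    RedStack-[] : ∀ A → RedStack A []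
    RedStack-[] (atom _) = refl
    RedStack-[] ⊥'       = refl
    RedStack-[] (A ⇒ B)  = tt
    RedStack-[] (A ∧ B)  = tt
    RedStack-[] (A ∨ B)  = (λ P r → SN-ω₁ (Red⇒SN A r)) , (λ P r → SN-ω₂ (Red⇒SN B r))

    Red⇒SN : ∀ A {M} → Red A M → SN M
    Red⇒SN A r = r [] (RedStack-[] A)

  mutual
    RedStack⇒SNₛ : ∀ A {K} → RedStack A K → SNₛ K
    RedStack⇒SNₛ (atom _) refl                  = SNₛ-[]
    RedStack⇒SNₛ ⊥'       refl                  = SNₛ-[]
    RedStack⇒SNₛ (A ⇒ B)  {[]}        _         = SNₛ-[]
    RedStack⇒SNₛ (A ⇒ B)  {arg N ∷ K} (r , k)   = SNₛ-arg (Red⇒SN A r) (RedStack⇒SNₛ B k)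
    RedStack⇒SNₛ (A ∧ B)  {[]}        _         = SNₛ-[]
    RedStack⇒SNₛ (A ∧ B)  {π₁ ∷ K}    k         = SNₛ-π₁ (RedStack⇒SNₛ A k)
    RedStack⇒SNₛ (A ∧ B)  {π₂ ∷ K}    k         = SNₛ-π₂ (RedStack⇒SNₛ B k)
    RedStack⇒SNₛ (A ∨ B)  (inj₁-ok , _)         = SNₛ-plug (inj₁-ok (var zero) (Red-var A))

    Red-var : ∀ A {x} → Red A (var x)
    Red-var A K k = SN-plug-var (RedStack⇒SNₛ A k)

  Red-lam : ∀ {A B M} → (∀ N → Red A N → Red B (M [0:= N ])) → Red (A ⇒ B) (lam M)
  Red-lam {A} {B} {M} body [] _ =
    SN-app-fun (SN-expand-lam {M} {var zero} {[]} (body (var zero) (Red-var A) [] (RedStack-[] B))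
                                                  (Red⇒SN A (Red-var A)))
  Red-lam {A} {M = M} body (arg N ∷ K) (r , k) =
    SN-expand-lam {M} {N} {K} (body N r K k) (Red⇒SN A r)

  Red-pair : ∀ {A₁ A₂ M₁ M₂} → Red A₁ M₁ → Red A₂ M₂ → Red (A₁ ∧ A₂) (pair M₁ M₂)
  Red-pair {A₁} {A₂} r₁ r₂ []       k = SN-pair (Red⇒SN A₁ r₁) (Red⇒SN A₂ r₂)
  Red-pair {A₁} {A₂} {M₁} {M₂} r₁ r₂ (π₁ ∷ K) k = SN-expand-π₁ {M₁} {M₂} {K} (r₁ K k) (Red⇒SN A₂ r₂)
  Red-pair {A₁} {A₂} {M₁} {M₂} r₁ r₂ (π₂ ∷ K) k = SN-expand-π₂ {M₁} {M₂} {K} (r₂ K k) (Red⇒SN A₁ r₁)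
  Red-pair r₁ r₂ (arg _ ∷ K)    ()
  Red-pair r₁ r₂ (case _ _ ∷ K) ()

  Red-case : ∀ {A₁ A₂ C M N₁ N₂} → Red (A₁ ∨ A₂) M →
             (∀ P → Red A₁ P → Red C (N₁ [0:= P ])) → (∀ P → Red A₂ P → Red C (N₂ [0:= P ])) →
             Red C (app M (case N₁ N₂))
  Red-case {A₁} {A₂} {C} {M} {N₁} {N₂} rM body₁ body₂ K k = rM (case N₁ N₂ ∷ K) (inj₁-ok , inj₂-ok)
    where
    case-SN : SNₛ (case N₁ N₂ ∷ K)
    case-SN = SNₛ-case (SN-plug-weakenT N₁ K (body₁ (var zero) (Red-var A₁) K k))
                       (SN-plug-weakenT N₂ K (body₂ (var zero) (Red-var A₂) K k))

    inj₁-ok : ∀ P → Red A₁ P → SN (plug (ω₁ P) (case N₁ N₂ ∷ K))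
    inj₁-ok P r = SN-expand-ω₁ (body₁ P r K k) (Red⇒SN A₁ r) case-SN

    inj₂-ok : ∀ P → Red A₂ P → SN (plug (ω₂ P) (case N₁ N₂ ∷ K))
    inj₂-ok P r = SN-expand-ω₂ (body₂ P r K k) (Red⇒SN A₂ r) case-SN

  Red-mu : ∀ {A N} → (∀ K → RedStack A K → SN (ssubStack zero (weakenM K) N)) → Red A (mu N)
  Red-mu {A} body K k = SN-expand-mu (body K k) (RedStack⇒SNₛ A k)

  RedSub : List (Ty 𝒜) → (ℕ → Term) → Set
  RedSub Γ σ = ∀ {x B} → Γ ∋ x ⦂ B → Red B (σ x)

  RedStacks : List (Ty 𝒜) → (ℕ → Stack) → Set
  RedStacks Δ θ = ∀ {α B} → Δ ∋ α ⦂ B → RedStack B (θ α)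

  consSub : Term → (ℕ → Term) → ℕ → Term
  consSub N σ zero    = N
  consSub N σ (suc x) = σ x

  consStack : Stack → (ℕ → Stack) → ℕ → Stack
  consStack K θ zero    = K
  consStack K θ (suc α) = θ α

  redSub-cons : ∀ {Γ σ A N} → RedSub Γ σ → Red A N → RedSub (A ∷ Γ) (consSub N σ)
  redSub-cons hσ r here      = r
  redSub-cons hσ r (there v) = hσ v

  redStacks-cons : ∀ {Δ θ A K} → RedStacks Δ θ → RedStack A K → RedStacks (A ∷ Δ) (consStack K θ)
  redStacks-cons hθ k here      = k
  redStacks-cons hθ k (there v) = hθ v

  record _∣_⊨_⦂_ (Γ Δ : List (Ty 𝒜)) (M : Term) (A : Ty 𝒜) : Set where
    constructor valid
    field red-inst : ∀ σ ρ θ → RedSub Γ σ → RedStacks Δ θ → Red A (inst σ ρ θ M)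

  open _∣_⊨_⦂_

  inst-[0:=] : ∀ σ ρ θ M N → inst (exts σ) ρ (weakenT ∘ θ) M [0:= N ] ≡ inst (consSub N σ) ρ θ M
  inst-[0:=] σ ρ θ M N = sub-inst after-exts (λ β → weakenT-[0:=] N (θ β)) M
    where
    after-exts : sub (single N) ∘ exts σ ≗ consSub N σ
    after-exts zero    = refl
    after-exts (suc x) = [0:=]-renT-suc N (σ x)

  ⊨-body : ∀ {Γ Δ A B M} → (A ∷ Γ) ∣ Δ ⊨ M ⦂ B → ∀ {σ ρ θ} → RedSub Γ σ → RedStacks Δ θ →
           ∀ N → Red A N → Red B (inst (exts σ) ρ (weakenT ∘ θ) M [0:= N ])
  ⊨-body {B = B} {M} ⊨M {σ} {ρ} {θ} hσ hθ N r =
    subst (Red B) (sym (inst-[0:=] σ ρ θ M N)) (red-inst ⊨M (consSub N σ) ρ θ (redSub-cons hσ r) hθ)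

  ⊨-lam : ∀ {Γ Δ A B M} → (A ∷ Γ) ∣ Δ ⊨ M ⦂ B → Γ ∣ Δ ⊨ lam M ⦂ (A ⇒ B)
  ⊨-lam ⊨M = valid λ σ ρ θ hσ hθ → Red-lam (⊨-body ⊨M hσ hθ)

  ⊨-case : ∀ {Γ Δ A₁ A₂ C M N₁ N₂} → Γ ∣ Δ ⊨ M ⦂ (A₁ ∨ A₂) →
           (A₁ ∷ Γ) ∣ Δ ⊨ N₁ ⦂ C → (A₂ ∷ Γ) ∣ Δ ⊨ N₂ ⦂ C → Γ ∣ Δ ⊨ app M (case N₁ N₂) ⦂ C
  ⊨-case {A₁ = A₁} {A₂} {C} {N₁ = N₁} {N₂} ⊨M ⊨N₁ ⊨N₂ = valid λ σ ρ θ hσ hθ →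
    Red-case {A₁} {A₂} {C} (red-inst ⊨M σ ρ θ hσ hθ) (⊨-body {M = N₁} ⊨N₁ hσ hθ) (⊨-body {M = N₂} ⊨N₂ hσ hθ)

  weakenM-pred : ∀ K → map (renME pred) (weakenM K) ≡ K
  weakenM-pred K = trans (sym (map-∘ K)) (trans (map-cong pred-suc K) (map-id K))
    where
    pred-suc : ∀ e → renME pred (renME suc e) ≡ e
    pred-suc e = trans (renME-∘ (λ _ → refl) e) (renME-id (λ _ → refl) e)

  -- After the μ-steps the body carries the stack K at μ-variable 0.  Renaming μ-variables
  -- by pred merges 0 with the next one, which is harmless since any renaming reflects SN,
  -- and yields an instance of the body's own validity with K at the new variable 0.
  ⊨-mu : ∀ {Γ Δ A M} → Γ ∣ (A ∷ Δ) ⊨ M ⦂ ⊥' → Γ ∣ Δ ⊨ mu M ⦂ A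
  ⊨-mu {A = A} {M} ⊨M = valid λ σ ρ θ hσ hθ → Red-mu {A} (body σ ρ θ hσ hθ)
    where
    body : ∀ σ ρ θ → RedSub _ σ → RedStacks _ θ → ∀ K → RedStack A K →
           SN (ssubStack zero (weakenM K) (inst (extsM σ) (ext ρ) (liftStacks θ) M))
    body σ ρ θ hσ hθ K k = subst SN (sym after-μ-steps) (SN-reflect (renM pred) (renM-▷ pred) (subst SN (sym renamed) ih))
      where
      θK = appendAt-zero (liftStacks θ) (weakenM K)

      after-μ-steps : ssubStack zero (weakenM K) (inst (extsM σ) (ext ρ) (liftStacks θ) M)
                    ≡ inst (extsM σ) (ext ρ) θK M
      after-μ-steps = ssubStack-inst (weakenM K) (fresh-zero-renM-suc ∘ σ) fresh-lifted
                                     (map⁺ (All.universal fresh-zero-renME-suc K)) M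
        where
        fresh-lifted : FreshStacks zero (liftStacks θ)
        fresh-lifted zero    = []
        fresh-lifted (suc β) = map⁺ (All.universal fresh-zero-renME-suc (θ β))

      renamed : renM pred (inst (extsM σ) (ext ρ) θK M) ≡ inst σ (pred ∘ ext ρ) (consStack K θ) M
      renamed = renM-inst (λ x → trans (renM-∘ (λ _ → refl) (σ x)) (renM-id (λ _ → refl) (σ x)))
                          (λ _ → refl) unshift M
        where
        unshift : map (renME pred) ∘ θK ≗ consStack K θ
        unshift zero    = weakenM-pred K
        unshift (suc β) = weakenM-pred (θ β)

      ih : SN (inst σ (pred ∘ ext ρ) (consStack K θ) M)
      ih = red-inst ⊨M σ (pred ∘ ext ρ) (consStack K θ) hσ (redStacks-cons hθ k) [] refl

  ⊨-app : ∀ {Γ Δ A B M N} → Γ ∣ Δ ⊨ M ⦂ (A ⇒ B) → Γ ∣ Δ ⊨ N ⦂ A → Γ ∣ Δ ⊨ app M (arg N) ⦂ B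
  ⊨-app ⊨M ⊨N = valid λ σ ρ θ hσ hθ K k →
    red-inst ⊨M σ ρ θ hσ hθ (arg _ ∷ K) (red-inst ⊨N σ ρ θ hσ hθ , k)

  ⊨-named : ∀ {Γ Δ A α M} → Δ ∋ α ⦂ A → Γ ∣ Δ ⊨ M ⦂ A → Γ ∣ Δ ⊨ named α M ⦂ ⊥'
  ⊨-named {α = α} v ⊨M = valid λ σ ρ θ hσ hθ → λ { [] refl → SN-named (red-inst ⊨M σ ρ θ hσ hθ (θ α) (hθ v)) }

  ⊨-pair : ∀ {Γ Δ A₁ A₂ M₁ M₂} → Γ ∣ Δ ⊨ M₁ ⦂ A₁ → Γ ∣ Δ ⊨ M₂ ⦂ A₂ → Γ ∣ Δ ⊨ pair M₁ M₂ ⦂ (A₁ ∧ A₂)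
  ⊨-pair {A₁ = A₁} {A₂} ⊨M₁ ⊨M₂ = valid λ σ ρ θ hσ hθ →
    Red-pair {A₁} {A₂} (red-inst ⊨M₁ σ ρ θ hσ hθ) (red-inst ⊨M₂ σ ρ θ hσ hθ)

  ⊨-π₁ : ∀ {Γ Δ A₁ A₂ M} → Γ ∣ Δ ⊨ M ⦂ (A₁ ∧ A₂) → Γ ∣ Δ ⊨ app M π₁ ⦂ A₁
  ⊨-π₁ ⊨M = valid λ σ ρ θ hσ hθ K → red-inst ⊨M σ ρ θ hσ hθ (π₁ ∷ K)

  ⊨-π₂ : ∀ {Γ Δ A₁ A₂ M} → Γ ∣ Δ ⊨ M ⦂ (A₁ ∧ A₂) → Γ ∣ Δ ⊨ app M π₂ ⦂ A₂
  ⊨-π₂ ⊨M = valid λ σ ρ θ hσ hθ K → red-inst ⊨M σ ρ θ hσ hθ (π₂ ∷ K)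

  ⊨-ω₁ : ∀ {Γ Δ A₁ A₂ M} → Γ ∣ Δ ⊨ M ⦂ A₁ → Γ ∣ Δ ⊨ ω₁ M ⦂ (A₁ ∨ A₂)
  ⊨-ω₁ ⊨M = valid λ σ ρ θ hσ hθ K (inj₁-ok , _) → inj₁-ok _ (red-inst ⊨M σ ρ θ hσ hθ)

  ⊨-ω₂ : ∀ {Γ Δ A₁ A₂ M} → Γ ∣ Δ ⊨ M ⦂ A₂ → Γ ∣ Δ ⊨ ω₂ M ⦂ (A₁ ∨ A₂)
  ⊨-ω₂ ⊨M = valid λ σ ρ θ hσ hθ K (_ , inj₂-ok) → inj₂-ok _ (red-inst ⊨M σ ρ θ hσ hθ)

  fundamental : ∀ {Γ Δ M A} → Γ ∣ Δ ⊢ M ⦂ A → Γ ∣ Δ ⊨ M ⦂ A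
  fundamental (⊢var v)        = valid λ σ ρ θ hσ hθ → hσ v
  fundamental (⊢lam d)        = ⊨-lam (fundamental d)
  fundamental (⊢app d₁ d₂)    = ⊨-app (fundamental d₁) (fundamental d₂)
  fundamental (⊢named v d)    = ⊨-named v (fundamental d)
  fundamental (⊢mu d)         = ⊨-mu (fundamental d)
  fundamental (⊢pair d₁ d₂)   = ⊨-pair (fundamental d₁) (fundamental d₂)
  fundamental (⊢π₁ d)         = ⊨-π₁ (fundamental d)
  fundamental (⊢π₂ d)         = ⊨-π₂ (fundamental d)
  fundamental (⊢ω₁ d)         = ⊨-ω₁ (fundamental d)
  fundamental (⊢ω₂ d)         = ⊨-ω₂ (fundamental d)
  fundamental (⊢case d d₁ d₂) = ⊨-case (fundamental d) (fundamental d₁) (fundamental d₂)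

  typed⇒SN : ∀ {Γ Δ M A} → Γ ∣ Δ ⊢ M ⦂ A → SN M
  typed⇒SN {M = M} {A} d = subst SN (inst-id (λ _ → refl) (λ _ → refl) (λ _ → refl) M)
    (Red⇒SN A (red-inst (fundamental d) var id (λ _ → []) (λ {_} {B} _ → Red-var B) (λ {_} {B} _ → RedStack-[] B)))

SN⇒NoInfiniteReduction : ∀ {M} → SN M → NoInfiniteReduction M
SN⇒NoInfiniteReduction (sn h) (f , refl , steps) =
  SN⇒NoInfiniteReduction (h (steps zero)) (f ∘ suc , refl , steps ∘ suc)

theorem6p9 : {𝒜 : Set} (Γ Δ : List (Ty 𝒜)) (M : Term) (A : Ty 𝒜) →
    Γ ∣ Δ ⊢ M ⦂ A → NoInfiniteReduction M
theorem6p9 Γ Δ M A d = SN⇒NoInfiniteReduction (Reducibility.typed⇒SN d)
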